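{- Let $p>5$ be prime and let $\mathbf{x}=(x_1,x_2,x_3)\in\mathcal{X}^*(p)$. Suppose that for some $i\in\{1,2,3\}$ the coordinate $x_i$ is elliptic and the Legendre symbol satisfies \[\left(\frac{3x_i+2}{p}\right)=-1.\] Then $2^{\nu}$ divides $\mathrm{ord}_{p,i}(\mathbf{x})$, where $\nu=\nu_2(p+1)$ is the $2$-adic valuation of $p+1$.
   Context: $\mathcal{X}^*(p)$ denotes the set of nonzero solutions $(x_1,x_2,x_3)\in\mathbb{F}_p^3\setminus\{(0,0,0)\}$ of the Markoff equation $x_1^2+x_2^2+x_3^2=3x_1x_2x_3$. The rotations are the maps $\mathrm{rot}_1(x_1,x_2,x_3)=(x_1,x_3,3x_1x_3-x_2)$, $\mathrm{rot}_2(x_1,x_2,x_3)=(x_3,x_2,3x_2x_3-x_1)$, $\mathrm{rot}_3(x_1,x_2,x_3)=(x_2,3x_2x_3-x_1,x_3)$ on $\mathcal{X}^*(p)$. The $i$th rotation order is $\mathrm{ord}_{p,i}(\mathbf{x})=\min\{n\in\mathbb{Z}_{>0}: \mathrm{rot}_i^n(\mathbf{x})\equiv\mathbf{x}\pmod p\}$ (equivalently, the order of $\begin{pmatrix}0&1\\-1&3x_i\end{pmatrix}$ in $\mathrm{GL}_2(\mathbb{F}_p)$). For $x\in\mathbb{F}_p$, let $\Delta_x=9x^2-4$ be the discriminant of $T^2-3xT+1$; $x$ is called elliptic if $\Delta_x$ is not a square modulo $p$. -}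

module Defs where

open import Data.Nat using (ℕ; zero; suc; _+_; _*_; _∸_; _^_; _<_; NonZero)
open import Data.Nat.DivMod using (_%_)
open import Data.Nat.Divisibility using (_∣_)
open import Data.Fin using (Fin; zero; suc)
open import Data.Product using (_×_; _,_; ∃)
open import Relation.Binary.PropositionalEquality using (_≡_; _≢_)
open import Relation.Nullary using (¬_)

-- Elements of F_p are represented by natural numbers < p; points of F_p^3
-- by triples of such numbers.
Triple : Set
Triple = ℕ × ℕ × ℕ

InFp³ : ℕ → Triple → Set
InFp³ p (x₁ , x₂ , x₃) = x₁ < p × x₂ < p × x₃ < p

InXstar : (p : ℕ) → .{{NonZero p}} → Triple → Set
InXstar p (x₁ , x₂ , x₃) =
  InFp³ p (x₁ , x₂ , x₃) ×
  ¬ (x₁ ≡ 0 × x₂ ≡ 0 × x₃ ≡ 0) ×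
  ((x₁ * x₁ + x₂ * x₂ + x₃ * x₃) % p ≡ (3 * x₁ * x₂ * x₃) % p)

-- 3ab - c in F_p (for c < p): computed as (3ab + (p - c)) mod p
rotTerm : (p : ℕ) → .{{NonZero p}} → ℕ → ℕ → ℕ → ℕ
rotTerm p a b c = (3 * a * b + (p ∸ c)) % p

-- the three rotations rot₁, rot₂, rot₃ (index 0,1,2 in Fin 3)
rot : (p : ℕ) → .{{NonZero p}} → Fin 3 → Triple → Triple
rot p zero (x₁ , x₂ , x₃) = (x₁ , x₃ , rotTerm p x₁ x₃ x₂)
rot p (suc zero) (x₁ , x₂ , x₃) = (x₃ , x₂ , rotTerm p x₂ x₃ x₁)
rot p (suc (suc zero)) (x₁ , x₂ , x₃) = (x₂ , rotTerm p x₂ x₃ x₁ , x₃)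

iter : {A : Set} → ℕ → (A → A) → A → A
iter zero f a = a
iter (suc n) f a = f (iter n f a)

IsRotOrder : (p : ℕ) → .{{NonZero p}} → Fin 3 → Triple → ℕ → Set
IsRotOrder p i x n =
  0 < n × iter n (rot p i) x ≡ x ×
  (∀ m → 0 < m → m < n → iter m (rot p i) x ≢ x)

coord : Fin 3 → Triple → ℕ
coord zero (x₁ , _ , _) = x₁
coord (suc zero) (_ , x₂ , _) = x₂
coord (suc (suc zero)) (_ , _ , x₃) = x₃

IsSquareMod : (p : ℕ) → .{{NonZero p}} → ℕ → Set
IsSquareMod p a = ∃ λ y → (y * y) % p ≡ a % p

LegendreMinusOne : (p : ℕ) → .{{NonZero p}} → ℕ → Set
LegendreMinusOne p a = a % p ≢ 0 × ¬ IsSquareMod p a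

-- x is elliptic: Δ_x = 9x² - 4 is not a square mod p,
-- i.e. there is no y with y² ≡ 9x² - 4, i.e. y² + 4 ≡ 9x² (mod p)
Elliptic : (p : ℕ) → .{{NonZero p}} → ℕ → Set
Elliptic p x = ¬ (∃ λ y → (y * y + 4) % p ≡ (9 * x * x) % p)

IsTwoAdicVal : ℕ → ℕ → Set
IsTwoAdicVal ν m = (2 ^ ν ∣ m) × ¬ (2 ^ suc ν ∣ m)

{-# OPTIONS --safe #-}
module Submission where

-- Write t = 3xᵢ. On the two other coordinates rotᵢ acts as (a , b) ↦ (b , tb - a), which
-- becomes multiplication by a root θ of T² - tT + 1 in 𝔽ₚ[θ]. As Δ = t² - 4 is a non-residue,
-- Euler's criterion gives (2θ - t)ᵖ = -(2θ - t), so by Frobenius θᵖ is the conjugate t - θ and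
-- θ^(p+1) = θ(t - θ) = 1. As t + 2 is a non-residue too and μ = 1 + θ satisfies μ² = (t + 2)θ,
-- comparing μ^(p+1) = μ(1 + t - θ) = t + 2 with ((t + 2)θ)^((p+1)/2) gives θ^((p+1)/2) = -1.
-- So a nonzero orbit closes after p + 1 steps but not after (p + 1)/2: its length divides p + 1
-- but not (p + 1)/2, hence carries the full power of 2 in p + 1. Euler's criterion and Wilson's
-- theorem both come from pairing each unit y with c/y, Frobenius from the binomial theorem.

open import Algebra.Bundles using (CommutativeSemiring; CommutativeRing)
open import Data.Integer.Base using (ℤ)
open import Data.Nat.Base as ℕ using (ℕ)
open import Data.Nat.Primality using (Prime)
open import Relation.Binary.PropositionalEquality using (_≡_)

module Primes where

  open import Data.Nat.Base using (zero; suc; _+_; _≤_; _<_; _∸_; _*_; _^_; _!; nonTrivial⇒n>1)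
  open import Data.Nat.Combinatorics using (_C_; nCk≡n!/k![n-k]!; k![n∸k]!∣n!)
  open import Data.Nat.Divisibility using (_∣_; divides; ∣⇒≤; ∣-trans; m∣m*n; *-cancelˡ-∣; *-monoʳ-∣; 1∣_)
  open import Data.Nat.DivMod using (m/n*n≡m)
  open import Data.Nat.Primality using (euclidsLemma; prime[2]; prime⇒nonTrivial; prime⇒irreducible)
  open import Data.Nat.Properties using (<⇒≱; <⇒≤; <⇒≢; <-trans; n<1+n; ∸-monoʳ-<; +-suc; *-comm; _!*_!≢0)
  open import Data.Nat.Tactic.RingSolver using (solve-∀)
  open import Data.Product.Base using (∃; _,_)
  open import Data.Sum.Base using (_⊎_; inj₁; inj₂)
  open import Relation.Binary.PropositionalEquality using (refl; sym; trans; cong; subst)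
  open import Relation.Nullary.Negation using (¬_; contradiction)

  p∤m! : ∀ {p} → Prime p → ∀ m → m < p → ¬ p ∣ m !
  p∤m! pr zero _ p∣1 with prime⇒nonTrivial pr
  ... | nt = <⇒≱ (nonTrivial⇒n>1 _ {{nt}}) (∣⇒≤ p∣1)
  p∤m! pr (suc m) m<p p∣m! with euclidsLemma (suc m) (m !) pr p∣m!
  ... | inj₁ p∣1+m = <⇒≱ m<p (∣⇒≤ p∣1+m)
  ... | inj₂ p∣m!  = p∤m! pr m (<-trans (n<1+n m) m<p) p∣m!

  n!≡nCk*k![n∸k]! : ∀ {n k} → k ≤ n → n ! ≡ (n C k) * (k ! * (n ∸ k) !)
  n!≡nCk*k![n∸k]! {n} {k} k≤n =
    trans (sym (m/n*n≡m (k![n∸k]!∣n! k≤n))) (cong (_* (k ! * (n ∸ k) !)) (sym (nCk≡n!/k![n-k]! k≤n)))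
    where instance _ = k !* (n ∸ k) !≢0

  p∣pCk : ∀ {p k} → Prime p → 0 < k → k < p → p ∣ p C k
  p∣pCk {p@(suc p-1)} {k} pr 0<k k<p
    with euclidsLemma (p C k) (k ! * (p ∸ k) !) pr (subst (p ∣_) (n!≡nCk*k![n∸k]! (<⇒≤ k<p)) (m∣m*n (p-1 !)))
  ... | inj₁ p∣pCk = p∣pCk
  ... | inj₂ p∣k![p∸k]! with euclidsLemma (k !) ((p ∸ k) !) pr p∣k![p∸k]!
  ...   | inj₁ p∣k!     = contradiction p∣k! (p∤m! pr k k<p)
  ...   | inj₂ p∣[p∸k]! = contradiction p∣[p∸k]! (p∤m! pr (p ∸ k) (∸-monoʳ-< 0<k (<⇒≤ k<p)))

  parity : ∀ n → ∃ λ h → n ≡ h + h ⊎ n ≡ suc (h + h)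
  parity zero    = 0 , inj₁ refl
  parity (suc n) with parity n
  ... | h , inj₁ n≡2h   = h , inj₂ (cong suc n≡2h)
  ... | h , inj₂ n≡1+2h = suc h , inj₁ (trans (cong suc n≡1+2h) (sym (+-suc (suc h) h)))

  2∣h+h : ∀ h → 2 ∣ h + h
  2∣h+h h = divides h (h+h≡h*2 h)
    where
    h+h≡h*2 : ∀ h → h + h ≡ h * 2
    h+h≡h*2 = solve-∀

  odd-prime : ∀ {p} → Prime p → 2 < p → ∃ λ h → p ≡ suc (h + h)
  odd-prime {p} pr 2<p with parity p
  ... | h , inj₂ p≡1+2h = h , p≡1+2h
  ... | h , inj₁ p≡2h with prime⇒irreducible pr (subst (2 ∣_) (sym p≡2h) (2∣h+h h))
  ...   | inj₁ ()
  ...   | inj₂ 2≡p = contradiction 2≡p (<⇒≢ 2<p)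

  2^ν∣k*n⇒2^ν∣n : ∀ ν {k n} → ¬ 2 ∣ k → 2 ^ ν ∣ k * n → 2 ^ ν ∣ n
  2^ν∣k*n⇒2^ν∣n zero    {n = n} _ _ = 1∣ n
  2^ν∣k*n⇒2^ν∣n (suc ν) {k} {n} 2∤k 2^[1+ν]∣kn with euclidsLemma k n prime[2] (∣-trans (m∣m*n (2 ^ ν)) 2^[1+ν]∣kn)
  ... | inj₁ 2∣k             = contradiction 2∣k 2∤k
  ... | inj₂ (divides q refl) =
    subst (2 ^ suc ν ∣_) (*-comm 2 q)
      (*-monoʳ-∣ 2 (2^ν∣k*n⇒2^ν∣n ν 2∤k (*-cancelˡ-∣ 2 (subst (2 ^ suc ν ∣_) (k[q2]≡2[kq] k q) 2^[1+ν]∣kn))))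
    where
    k[q2]≡2[kq] : ∀ k q → k * (q * 2) ≡ 2 * (k * q)
    k[q2]≡2[kq] = solve-∀

module Frobenius {c ℓ} (R : CommutativeSemiring c ℓ) where

  open import Data.Fin.Base using (zero; suc; fromℕ)
  open import Data.Fin.Properties using (toℕ-fromℕ; inject₁ℕ<)
  open import Data.Nat.Base using (zero; suc; s≤s; z≤n)
  open import Data.Nat.Combinatorics using (nCn≡1)
  open import Data.Nat.Divisibility using (_∣_; divides)
  open import Data.Nat.Primality using (prime⇒nonZero)
  import Data.Nat.Properties as ℕₚ
  open import Data.Vec.Functional using (init; tail)
  import Relation.Binary.PropositionalEquality as ≡
  open Primes using (p∣pCk)
  open CommutativeSemiring R hiding (zero)
  open import Algebra.Properties.Semiring.Mult semiring
  open import Algebra.Properties.Semiring.Exp semiring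
  open import Algebra.Properties.CommutativeSemiring.Binomial R
  open import Algebra.Properties.Monoid.Sum +-monoid
  open import Relation.Binary.Reasoning.Setoid setoid

  p∣m⇒m×x≈0 : ∀ {p m} → p × 1# ≈ 0# → p ∣ m → ∀ x → m × x ≈ 0#
  p∣m⇒m×x≈0 {p} p×1≈0 (divides q ≡.refl) x = begin
    (q ℕ.* p) × x       ≡⟨ ≡.cong (_× x) (ℕₚ.*-comm q p) ⟩
    (p ℕ.* q) × x       ≈⟨ ×-assocˡ x p q ⟨
    p × (q × x)         ≈⟨ ×-congʳ p (*-identityˡ _) ⟨
    p × (1# * (q × x))  ≈⟨ ×-assoc-* p 1# (q × x) ⟨
    (p × 1#) * (q × x)  ≈⟨ *-congʳ p×1≈0 ⟩
    0# * (q × x)        ≈⟨ zeroˡ _ ⟩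
    0#                  ∎

  1^n≈1 : ∀ n → 1# ^ n ≈ 1#
  1^n≈1 zero    = refl
  1^n≈1 (suc n) = trans (*-identityˡ _) (1^n≈1 n)

  [x+y]^p≈x^p+y^p : ∀ {p} → Prime p → p × 1# ≈ 0# → ∀ x y → (x + y) ^ p ≈ x ^ p + y ^ p
  [x+y]^p≈x^p+y^p {zero} pr with () ← prime⇒nonZero pr
  [x+y]^p≈x^p+y^p {suc n} pr p×1≈0 x y = begin
    (x + y) ^ suc n                                             ≈⟨ theorem (suc n) x y ⟩
    term zero + sum (tail term)                                 ≈⟨ +-congˡ (sum-init-last (tail term)) ⟩
    term zero + (sum (init (tail term)) + term (suc (fromℕ n))) ≈⟨ +-cong first (+-cong middle last) ⟩
    y ^ suc n + (0# + x ^ suc n)                                ≈⟨ +-congˡ (+-identityˡ _) ⟩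
    y ^ suc n + x ^ suc n                                       ≈⟨ +-comm _ _ ⟩
    x ^ suc n + y ^ suc n                                       ∎
    where
    term = binomialTerm x y (suc n)
    first : term zero ≈ y ^ suc n
    first = trans (×-homo-1 _) (*-identityˡ _)
    last : term (suc (fromℕ n)) ≈ x ^ suc n
    last rewrite toℕ-fromℕ n | nCn≡1 (suc n) | ℕₚ.n∸n≡0 n = trans (×-homo-1 _) (*-identityʳ _)
    middle : sum (init (tail term)) ≈ 0#
    middle = trans (sum-cong-≋ (λ i → p∣m⇒m×x≈0 p×1≈0 (p∣pCk pr (s≤s z≤n) (s≤s (inject₁ℕ< i))) _))
                   (sum-replicate-zero n)

  [m×1]^p≈m×1 : ∀ {p} → Prime p → p × 1# ≈ 0# → ∀ m → (m × 1#) ^ p ≈ m × 1#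
  [m×1]^p≈m×1 {zero} pr with () ← prime⇒nonZero pr
  [m×1]^p≈m×1 {suc n} pr p×1≈0 zero    = zeroˡ _
  [m×1]^p≈m×1 {p}     pr p×1≈0 (suc m) = begin
    (1# + m × 1#) ^ p      ≈⟨ [x+y]^p≈x^p+y^p pr p×1≈0 1# (m × 1#) ⟩
    1# ^ p + (m × 1#) ^ p  ≈⟨ +-cong (1^n≈1 p) ([m×1]^p≈m×1 pr p×1≈0 m) ⟩
    1# + m × 1#            ∎

module FreeInvolution {a} {A : Set a} where

  open import Data.List.Base using (List; _∷_)
  open import Data.List.Membership.Propositional using (_∈_; _∉_)
  open import Data.List.Relation.Unary.All as All using (All)
  open import Data.List.Relation.Unary.All.Properties using (─⁺)
  open import Data.List.Relation.Unary.AllPairs as AllPairs using (_∷_)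
  open import Data.List.Relation.Unary.Any using (here; there; _─_)
  open import Data.List.Relation.Unary.Unique.Propositional using (Unique)
  open import Data.List.Relation.Unary.Unique.Propositional.Properties using (Unique[x∷xs]⇒x∉xs)
  open import Relation.Binary.PropositionalEquality using (_≡_; _≢_; refl; sym; trans; cong; subst)
  open import Relation.Nullary.Negation using (contradiction)

  ∈-tail : ∀ {x z} {xs : List A} → z ∈ x ∷ xs → z ≢ x → z ∈ xs
  ∈-tail (here z≡x) z≢x = contradiction z≡x z≢x
  ∈-tail (there z∈) _   = z∈

  ∈-─⁻ : ∀ {xs : List A} {y z} (y∈xs : y ∈ xs) → z ∈ (xs ─ y∈xs) → z ∈ xs
  ∈-─⁻ (here _)  z∈         = there z∈
  ∈-─⁻ (there _) (here z≡x) = here z≡x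
  ∈-─⁻ (there m) (there z∈) = there (∈-─⁻ m z∈)

  ∈-─⁺ : ∀ {xs : List A} {y z} (y∈xs : y ∈ xs) → z ∈ xs → z ≢ y → z ∈ (xs ─ y∈xs)
  ∈-─⁺ (here refl) (here z≡y) z≢y = contradiction z≡y z≢y
  ∈-─⁺ (here refl) (there z∈) _   = z∈
  ∈-─⁺ (there _)   (here z≡x) _   = here z≡x
  ∈-─⁺ (there m)   (there z∈) z≢y = there (∈-─⁺ m z∈ z≢y)

  Unique-─ : ∀ {xs : List A} {y} (y∈xs : y ∈ xs) → Unique xs → Unique (xs ─ y∈xs)
  Unique-─ (here _)  (_ ∷ u)   = u
  Unique-─ (there m) (x≢ ∷ u) = ─⁺ m x≢ ∷ Unique-─ m u

  ∉-─ : ∀ {xs : List A} {y} (y∈xs : y ∈ xs) → Unique xs → y ∉ (xs ─ y∈xs)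
  ∉-─ (here refl) (y≢ ∷ _) y∈         = All.lookup y≢ y∈ refl
  ∉-─ (there m)   (x≢ ∷ _) (here y≡x) = All.lookup x≢ m (sym y≡x)
  ∉-─ (there m)   (_ ∷ u)  (there y∈) = ∉-─ m u y∈

  record FreeInvolutionOn (σ : A → A) (xs : List A) : Set a where
    field
      closed           : ∀ {y} → y ∈ xs → σ y ∈ xs
      fixed-point-free : ∀ {y} → y ∈ xs → σ y ≢ y
      involutive       : ∀ {y} → y ∈ xs → σ (σ y) ≡ y

  module _ {σ : A → A} {x xs} (unique : Unique (x ∷ xs)) (free : FreeInvolutionOn σ (x ∷ xs)) where

    open FreeInvolutionOn free

    σx∈xs : σ x ∈ xs
    σx∈xs = ∈-tail (closed (here refl)) (fixed-point-free (here refl))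

    restrict : FreeInvolutionOn σ (xs ─ σx∈xs)
    restrict = record
      { closed           = closed′
      ; fixed-point-free = λ z∈ → fixed-point-free (there (∈-─⁻ σx∈xs z∈))
      ; involutive       = λ z∈ → involutive (there (∈-─⁻ σx∈xs z∈))
      }
      where
      closed′ : ∀ {z} → z ∈ (xs ─ σx∈xs) → σ z ∈ (xs ─ σx∈xs)
      closed′ {z} z∈ = ∈-─⁺ σx∈xs (∈-tail (closed z∈x∷xs) σz≢x) σz≢σx
        where
        z∈x∷xs : z ∈ x ∷ xs
        z∈x∷xs = there (∈-─⁻ σx∈xs z∈)
        σz≢x : σ z ≢ x
        σz≢x σz≡x = ∉-─ σx∈xs (AllPairs.tail unique)
          (subst (_∈ (xs ─ σx∈xs)) (trans (sym (involutive z∈x∷xs)) (cong σ σz≡x)) z∈)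
        σz≢σx : σ z ≢ σ x
        σz≢σx σz≡σx = Unique[x∷xs]⇒x∉xs unique (subst (_∈ xs)
          (trans (sym (involutive z∈x∷xs)) (trans (cong σ σz≡σx) (involutive (here refl))))
          (∈-─⁻ σx∈xs z∈))

module PairedProduct {c ℓ} (R : CommutativeSemiring c ℓ) where

  open import Data.List.Base using (List; []; _∷_; _∷ʳ_; map; foldr; length)
  open import Data.List.Membership.Propositional using (_∈_)
  open import Data.List.Properties using (length-removeAt′)
  open import Data.List.Relation.Unary.AllPairs as AllPairs using ()
  open import Data.List.Relation.Unary.Any using (here; there; index; _─_)
  open import Data.List.Relation.Unary.Unique.Propositional using (Unique)
  open import Data.Nat.Base using (zero; suc)
  open import Data.Nat.Properties using (suc-injective; +-suc)
  import Relation.Binary.PropositionalEquality as ≡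
  open FreeInvolution

  open CommutativeSemiring R hiding (zero)
  open import Algebra.Properties.CommutativeSemigroup *-commutativeSemigroup using (x∙yz≈y∙xz)
  open import Algebra.Properties.Semiring.Exp semiring using (_^_)
  open import Relation.Binary.Reasoning.Setoid setoid

  ∏ : List Carrier → Carrier
  ∏ = foldr _*_ 1#

  module _ {A : Set} (f : A → Carrier) where

    ∏-─ : ∀ {xs y} (y∈xs : y ∈ xs) → ∏ (map f xs) ≈ f y * ∏ (map f (xs ─ y∈xs))
    ∏-─ (here ≡.refl) = refl
    ∏-─ (there y∈xs)  = trans (*-congˡ (∏-─ y∈xs)) (x∙yz≈y∙xz _ _ _)

    ∏-∷ʳ : ∀ xs y → ∏ (map f (xs ∷ʳ y)) ≈ ∏ (map f xs) * f y
    ∏-∷ʳ []       y = trans (*-identityʳ (f y)) (sym (*-identityˡ (f y)))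
    ∏-∷ʳ (x ∷ xs) y = trans (*-congˡ (∏-∷ʳ xs y)) (sym (*-assoc _ _ _))

    ∏-pairs : ∀ {σ γ} k {xs} → length xs ≡.≡ k ℕ.+ k → Unique xs → FreeInvolutionOn σ xs →
              (∀ {y} → y ∈ xs → f y * f (σ y) ≈ γ) → ∏ (map f xs) ≈ γ ^ k
    ∏-pairs zero    {[]}    _   _      _    _    = refl
    ∏-pairs {σ} {γ} (suc k) {x ∷ xs} len unique free pair = begin
      f x * ∏ (map f xs)                           ≈⟨ *-congˡ (∏-─ σx∈xs′) ⟩
      f x * (f (σ x) * ∏ (map f (xs ─ σx∈xs′)))    ≈⟨ *-assoc _ _ _ ⟨
      f x * f (σ x) * ∏ (map f (xs ─ σx∈xs′))      ≈⟨ *-cong (pair (here ≡.refl)) (∏-pairs k len′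
                                                        (Unique-─ σx∈xs′ (AllPairs.tail unique))
                                                        (restrict unique free) (λ y∈ → pair (there (∈-─⁻ σx∈xs′ y∈)))) ⟩
      γ * γ ^ k                                    ∎
      where
      σx∈xs′ = σx∈xs unique free
      len′ : length (xs ─ σx∈xs′) ≡.≡ k ℕ.+ k
      len′ = suc-injective (≡.trans (≡.sym (length-removeAt′ xs (index σx∈xs′)))
                                    (≡.trans (suc-injective len) (+-suc k k)))

module Range where

  open import Data.List.Base using (List; applyUpTo)
  open import Data.List.Membership.Propositional using (_∈_)
  open import Data.List.Membership.Propositional.Properties using (∈-applyUpTo⁺; ∈-applyUpTo⁻)
  open import Data.List.Relation.Unary.Unique.Propositional using (Unique)
  open import Data.List.Relation.Unary.Unique.Propositional.Properties using (applyUpTo⁺₁)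
  open import Data.Nat.Base using (_+_; _≤_; _<_)
  open import Data.Nat.Properties using (m≤m+n; +-monoʳ-<; +-cancelˡ-<; m+[n∸m]≡n; <⇒≢)
  open import Data.Product.Base using (_×_; _,_)
  open import Relation.Binary.PropositionalEquality using (refl; sym; subst)

  range : ℕ → ℕ → List ℕ
  range a n = applyUpTo (a +_) n

  ∈-range⁻ : ∀ {a n y} → y ∈ range a n → a ≤ y × y < a + n
  ∈-range⁻ {a} y∈ with ∈-applyUpTo⁻ (a +_) y∈
  ... | i , i<n , refl = m≤m+n a i , +-monoʳ-< a i<n

  ∈-range⁺ : ∀ {a n y} → a ≤ y → y < a + n → y ∈ range a n
  ∈-range⁺ {a} {n} {y} a≤y y<a+n = subst (_∈ range a n) (m+[n∸m]≡n a≤y)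
    (∈-applyUpTo⁺ (a +_) (+-cancelˡ-< a _ _ (subst (_< a + n) (sym (m+[n∸m]≡n a≤y)) y<a+n)))

  range-unique : ∀ a n → Unique (range a n)
  range-unique a n = applyUpTo⁺₁ (a +_) n (λ i<j _ → <⇒≢ (+-monoʳ-< a i<j))

module LeastPeriod {A : Set} (F : A → A) where

  open import Data.Nat.Base using (zero; suc; _+_; _*_; _^_; _<_; s<s⁻¹; z<s)
  open import Data.Nat.DivMod using (_%_; _/_; m≡m%n+[m/n]*n; m%n<n)
  open import Data.Nat.Divisibility using (_∣_; divides; _∣?_; m%n≡0⇒n∣m)
  open import Data.Nat.Properties using (*-cancelˡ-≡)
  open import Data.Product.Base using (∃; _×_; _,_)
  open Primes using (2^ν∣k*n⇒2^ν∣n)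
  open import Relation.Binary.Definitions using (DecidableEquality)
  open import Relation.Binary.PropositionalEquality
  open import Relation.Nullary.Decidable using (yes; no)
  open import Relation.Nullary.Negation using (¬_; contradiction)
  open import Level using (0ℓ)
  open import Relation.Unary using (Pred; Decidable)
  open import Defs using (iter)
  open import Data.Nat.Tactic.RingSolver using (solve-∀)

  IsLeastPeriod : A → ℕ → Set
  IsLeastPeriod x n = 0 < n × iter n F x ≡ x × (∀ m → 0 < m → m < n → iter m F x ≢ x)

  least : ∀ {P : Pred ℕ 0ℓ} → Decidable P → ∀ {N} → P N → ∃ λ n → P n × (∀ {m} → m < n → ¬ P m)
  least P? {zero}  pN = 0 , pN , λ ()
  least P? {suc N} pN with P? 0
  ... | yes p0 = 0 , p0 , λ ()
  ... | no ¬p0 with least (λ n → P? (suc n)) pN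
  ...   | n , pn , min = suc n , pn , λ { {zero} _ → ¬p0 ; {suc m} m<n → min (s<s⁻¹ m<n) }

  leastPeriod : DecidableEquality A → ∀ {x N} → iter (suc N) F x ≡ x → ∃ (IsLeastPeriod x)
  leastPeriod _≟_ {x} {N} return with least (λ n → iter (suc n) F x ≟ x) {N} return
  ... | n , returnₙ , min = suc n , z<s , returnₙ , minimal
    where
    minimal : ∀ m → 0 < m → m < suc n → iter m F x ≢ x
    minimal (suc m) _ m<n = min (s<s⁻¹ m<n)

  iter-+ : ∀ m n {x} → iter (m + n) F x ≡ iter m F (iter n F x)
  iter-+ zero    n = refl
  iter-+ (suc m) n = cong F (iter-+ m n)

  iter-*-period : ∀ {n x} → iter n F x ≡ x → ∀ q → iter (q * n) F x ≡ x
  iter-*-period         return zero    = refl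
  iter-*-period {n} {x} return (suc q) = trans (iter-+ n (q * n)) (trans (cong (iter n F) (iter-*-period return q)) return)

  leastPeriod-∣ : ∀ {x n m} → IsLeastPeriod x n → iter m F x ≡ x → n ∣ m
  leastPeriod-∣ {x} {n@(suc _)} {m} (_ , returnₙ , minimal) returnₘ = m%n≡0⇒n∣m m n (remainder≡0 (m % n) refl)
    where
    returnᵣ : iter (m % n) F x ≡ x
    returnᵣ = begin
      iter (m % n) F x                       ≡⟨ cong (iter (m % n) F) (iter-*-period returnₙ (m / n)) ⟨
      iter (m % n) F (iter (m / n * n) F x)  ≡⟨ iter-+ (m % n) (m / n * n) ⟨
      iter (m % n + m / n * n) F x           ≡⟨ cong (λ k → iter k F x) (m≡m%n+[m/n]*n m n) ⟨
      iter m F x                             ≡⟨ returnₘ ⟩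
      x                                      ∎
      where open ≡-Reasoning
    remainder≡0 : ∀ r → r ≡ m % n → r ≡ 0
    remainder≡0 zero    _    = refl
    remainder≡0 (suc r) r≡ = contradiction (subst (λ k → iter k F x ≡ x) (sym r≡) returnᵣ)
                                           (minimal (suc r) z<s (subst (_< n) (sym r≡) (m%n<n m n)))

  -- Writing 2m = kn, k must be odd (else n ∣ m), so the 2-part of 2m divides n.
  leastPeriod-2-adic : ∀ {x n m ν} → IsLeastPeriod x n → iter (2 * m) F x ≡ x → iter m F x ≢ x →
                       2 ^ ν ∣ 2 * m → 2 ^ ν ∣ n
  leastPeriod-2-adic {x} {n} {m} {ν} period@(_ , returnₙ , _) return₂ₘ ¬returnₘ 2^ν∣2m
    with divides k 2m≡kn ← leastPeriod-∣ period return₂ₘ | 2 ∣? k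
  ... | no 2∤k                = 2^ν∣k*n⇒2^ν∣n ν 2∤k (subst (2 ^ ν ∣_) 2m≡kn 2^ν∣2m)
  ... | yes (divides j refl) = contradiction (trans (cong (λ l → iter l F x) m≡jn) (iter-*-period returnₙ j)) ¬returnₘ
    where
    m≡jn : m ≡ j * n
    m≡jn = *-cancelˡ-≡ m (j * n) 2 (trans 2m≡kn (j2n≡2[jn] j n))
      where
      j2n≡2[jn] : ∀ j n → j * 2 * n ≡ 2 * (j * n)
      j2n≡2[jn] = solve-∀

module Quotient {c ℓ} (R : CommutativeRing c ℓ) where

  open import Algebra.Definitions using (Congruent₁; Congruent₂)
  open import Algebra.Structures using (IsCommutativeRing)
  open import Data.Product.Base using (_,_)
  open import Relation.Binary.Core using (Rel; _⇒_)
  open import Relation.Binary.Structures using (IsEquivalence)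

  open CommutativeRing R

  quotientRing : ∀ {ℓ′} {_∼_ : Rel Carrier ℓ′} → IsEquivalence _∼_ → _≈_ ⇒ _∼_ →
                 Congruent₂ _∼_ _+_ → Congruent₂ _∼_ _*_ → Congruent₁ _∼_ (-_) →
                 CommutativeRing c ℓ′
  quotientRing {_∼_ = _∼_} isEquivalence ≈⇒∼ +-cong′ *-cong′ -‿cong′ = record
    { _≈_ = _∼_
    ; isCommutativeRing = isCommutativeRing′
    }
    where
    isCommutativeRing′ : IsCommutativeRing _∼_ _+_ _*_ (-_) 0# 1#
    isCommutativeRing′ = record
      { isRing = record
        { +-isAbelianGroup = record
          { isGroup = record
            { isMonoid = record
              { isSemigroup = record
                { isMagma = record { isEquivalence = isEquivalence ; ∙-cong = +-cong′ }
                ; assoc   = λ x y z → ≈⇒∼ (+-assoc x y z)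
                }
              ; identity = (λ x → ≈⇒∼ (+-identityˡ x)) , (λ x → ≈⇒∼ (+-identityʳ x))
              }
            ; inverse = (λ x → ≈⇒∼ (-‿inverseˡ x)) , (λ x → ≈⇒∼ (-‿inverseʳ x))
            ; ⁻¹-cong = -‿cong′
            }
          ; comm = λ x y → ≈⇒∼ (+-comm x y)
          }
        ; *-cong     = *-cong′
        ; *-assoc    = λ x y z → ≈⇒∼ (*-assoc x y z)
        ; *-identity = (λ x → ≈⇒∼ (*-identityˡ x)) , (λ x → ≈⇒∼ (*-identityʳ x))
        ; distrib    = (λ x y z → ≈⇒∼ (distribˡ x y z)) , (λ x y z → ≈⇒∼ (distribʳ x y z))
        }
      ; *-comm = λ x y → ≈⇒∼ (*-comm x y)
      }

module IntegersModulo where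

  open import Data.Integer.Base using (+_; -[1+_]; _+_; _*_; -_; _-_; 0ℤ; 1ℤ)
  open import Data.Integer.DivMod using (_%ℕ_; _/ℕ_; a≡a%ℕn+[a/ℕn]*n)
  open import Data.Nat.DivMod using (_%_; _/_; m≡m%n+[m/n]*n; [m+kn]%n≡m%n; m<n⇒m%n≡m)
  import Data.Integer.Properties as ℤ
  open import Data.Integer.Tactic.RingSolver using (solve-∀)
  open import Data.Nat.Base using (NonZero)
  open import Level using (0ℓ)
  open import Relation.Binary.PropositionalEquality
  open import Relation.Binary.Structures using (IsEquivalence)
  open Quotient ℤ.+-*-commutativeRing using (quotientRing)

  infix 4 _≡_mod_
  record _≡_mod_ (a b : ℤ) (n : ℕ) : Set where
    constructor ≡-mod
    field
      quotient : ℤ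
      a-b≡quotient*n : a - b ≡ quotient * + n

  private
    a-a≡0 : ∀ a → a - a ≡ 0ℤ
    a-a≡0 = solve-∀
    b-a≡-[a-b] : ∀ a b → b - a ≡ - (a - b)
    b-a≡-[a-b] = solve-∀
    a-c≡[a-b]+[b-c] : ∀ a b c → a - c ≡ (a - b) + (b - c)
    a-c≡[a-b]+[b-c] = solve-∀
    sum-difference : ∀ a b c d → (a + c) - (b + d) ≡ (a - b) + (c - d)
    sum-difference = solve-∀
    product-difference : ∀ a b c d → a * c - b * d ≡ (a - b) * c + b * (c - d)
    product-difference = solve-∀
    negation-difference : ∀ a b → - a - - b ≡ - (a - b)
    negation-difference = solve-∀

  module _ {n : ℕ} where

    ≡⇒≡-mod : ∀ {a b} → a ≡ b → a ≡ b mod n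
    ≡⇒≡-mod {a} refl = ≡-mod 0ℤ (trans (a-a≡0 a) (sym (ℤ.*-zeroˡ (+ n))))

    ≡-mod-sym : ∀ {a b} → a ≡ b mod n → b ≡ a mod n
    ≡-mod-sym {a} {b} (≡-mod k eq) = ≡-mod (- k) (begin
      b - a        ≡⟨ b-a≡-[a-b] a b ⟩
      - (a - b)    ≡⟨ cong -_ eq ⟩
      - (k * + n)  ≡⟨ ℤ.neg-distribˡ-* k (+ n) ⟩
      - k * + n    ∎)
      where open ≡-Reasoning

    ≡-mod-trans : ∀ {a b c} → a ≡ b mod n → b ≡ c mod n → a ≡ c mod n
    ≡-mod-trans {a} {b} {c} (≡-mod k eq₁) (≡-mod l eq₂) = ≡-mod (k + l) (begin
      a - c              ≡⟨ a-c≡[a-b]+[b-c] a b c ⟩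
      (a - b) + (b - c)  ≡⟨ cong₂ _+_ eq₁ eq₂ ⟩
      k * + n + l * + n  ≡⟨ ℤ.*-distribʳ-+ (+ n) k l ⟨
      (k + l) * + n      ∎)
      where open ≡-Reasoning

    ≡-mod-isEquivalence : IsEquivalence (λ a b → a ≡ b mod n)
    ≡-mod-isEquivalence = record
      { refl = ≡⇒≡-mod refl ; sym = ≡-mod-sym ; trans = ≡-mod-trans }

    +-cong-mod : ∀ {a b c d} → a ≡ b mod n → c ≡ d mod n → a + c ≡ b + d mod n
    +-cong-mod {a} {b} {c} {d} (≡-mod k eq₁) (≡-mod l eq₂) = ≡-mod (k + l) (begin
      (a + c) - (b + d)  ≡⟨ sum-difference a b c d ⟩
      (a - b) + (c - d)  ≡⟨ cong₂ _+_ eq₁ eq₂ ⟩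
      k * + n + l * + n  ≡⟨ ℤ.*-distribʳ-+ (+ n) k l ⟨
      (k + l) * + n      ∎)
      where open ≡-Reasoning

    *-cong-mod : ∀ {a b c d} → a ≡ b mod n → c ≡ d mod n → a * c ≡ b * d mod n
    *-cong-mod {a} {b} {c} {d} (≡-mod k eq₁) (≡-mod l eq₂) = ≡-mod (k * c + b * l) (begin
      a * c - b * d              ≡⟨ product-difference a b c d ⟩
      (a - b) * c + b * (c - d)  ≡⟨ cong₂ (λ x y → x * c + b * y) eq₁ eq₂ ⟩
      k * + n * c + b * (l * + n) ≡⟨ regroup k c b l (+ n) ⟩
      (k * c + b * l) * + n      ∎)
      where
      open ≡-Reasoning
      regroup : ∀ k c b l n → k * n * c + b * (l * n) ≡ (k * c + b * l) * n
      regroup = solve-∀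

    -‿cong-mod : ∀ {a b} → a ≡ b mod n → - a ≡ - b mod n
    -‿cong-mod {a} {b} (≡-mod k eq) = ≡-mod (- k) (begin
      - a - - b    ≡⟨ negation-difference a b ⟩
      - (a - b)    ≡⟨ cong -_ eq ⟩
      - (k * + n)  ≡⟨ ℤ.neg-distribˡ-* k (+ n) ⟩
      - k * + n    ∎)
      where open ≡-Reasoning

  ℤ/_ : ℕ → CommutativeRing 0ℓ 0ℓ
  ℤ/ n = quotientRing (≡-mod-isEquivalence {n}) ≡⇒≡-mod +-cong-mod *-cong-mod -‿cong-mod

  ≡-mod-intro : ∀ {n a b} k → a ≡ b + k * + n → a ≡ b mod n
  ≡-mod-intro {n} {a} {b} k a≡b+kn = ≡-mod k (trans (cong (_- b) a≡b+kn) (b+c-b≡c b (k * + n)))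
    where
    b+c-b≡c : ∀ b c → b + c - b ≡ c
    b+c-b≡c = solve-∀

  n≡0-mod : ∀ n → + n ≡ 0ℤ mod n
  n≡0-mod n = ≡-mod-intro 1ℤ (sym (trans (ℤ.+-identityˡ _) (ℤ.*-identityˡ (+ n))))

  module _ {n : ℕ} .{{_ : NonZero n}} where

    %-≡-mod : ∀ m → + (m % n) ≡ + m mod n
    %-≡-mod m = ≡-mod-sym (≡-mod-intro (+ (m / n)) (begin
      + m                          ≡⟨ cong +_ (m≡m%n+[m/n]*n m n) ⟩
      + (m % n ℕ.+ m / n ℕ.* n)    ≡⟨ ℤ.pos-+ (m % n) (m / n ℕ.* n) ⟩
      + (m % n) + + (m / n ℕ.* n)  ≡⟨ cong (_+_ (+ (m % n))) (ℤ.pos-* (m / n) n) ⟩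
      + (m % n) + + (m / n) * + n  ∎))
      where open ≡-Reasoning

    %ℕ-≡-mod : ∀ a → + (a %ℕ n) ≡ a mod n
    %ℕ-≡-mod a = ≡-mod-sym (≡-mod-intro (a /ℕ n) (a≡a%ℕn+[a/ℕn]*n a n))

    a-b≡kn⇒a%n≡b%n : ∀ {a b k} → + a - + b ≡ + k * + n → a % n ≡ b % n
    a-b≡kn⇒a%n≡b%n {a} {b} {k} eq = trans (cong (_% n) (ℤ.+-injective (begin
      + a                  ≡⟨ a≡b+[a-b] (+ a) (+ b) ⟩
      + b + (+ a - + b)    ≡⟨ cong (_+_ (+ b)) eq ⟩
      + b + + k * + n      ≡⟨ cong (_+_ (+ b)) (ℤ.pos-* k n) ⟨
      + b + + (k ℕ.* n)    ≡⟨ ℤ.pos-+ b (k ℕ.* n) ⟨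
      + (b ℕ.+ k ℕ.* n)    ∎))) ([m+kn]%n≡m%n b k n)
      where
      open ≡-Reasoning
      a≡b+[a-b] : ∀ a b → a ≡ b + (a - b)
      a≡b+[a-b] = solve-∀

    ≡-mod⇒%≡ : ∀ {a b} → + a ≡ + b mod n → a % n ≡ b % n
    ≡-mod⇒%≡ (≡-mod (+ k) eq)        = a-b≡kn⇒a%n≡b%n {k = k} eq
    ≡-mod⇒%≡ a≡b@(≡-mod -[1+ k ] _) = sym (a-b≡kn⇒a%n≡b%n {k = ℕ.suc k} (_≡_mod_.a-b≡quotient*n (≡-mod-sym a≡b)))

    ≡-mod⇒≡ : ∀ {a b} → a ℕ.< n → b ℕ.< n → + a ≡ + b mod n → a ≡ b
    ≡-mod⇒≡ a<n b<n a≡b = trans (sym (m<n⇒m%n≡m a<n)) (trans (≡-mod⇒%≡ a≡b) (m<n⇒m%n≡m b<n))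

module QuadraticIntegers (t : ℤ) where

  open import Data.Integer.Base using (+_; _+_; _*_; -_; _-_; 0ℤ; 1ℤ)
  import Data.Integer.Properties as ℤ
  open import Data.Integer.Tactic.RingSolver using (solve-∀)
  open import Data.Product.Base using (_×_; _,_)
  open import Data.Product.Relation.Binary.Pointwise.NonDependent using (Pointwise; ×-isEquivalence)
  open import Level using (0ℓ)
  open import Relation.Binary.PropositionalEquality
  open IntegersModulo

  infixl 6 _⊕_
  infixl 7 _⊗_

  -- (a , b) represents a + bθ, where θ² = tθ - 1.
  _⊕_ : ℤ × ℤ → ℤ × ℤ → ℤ × ℤ
  (a , b) ⊕ (c , d) = (a + c , b + d)

  _⊗_ : ℤ × ℤ → ℤ × ℤ → ℤ × ℤ
  (a , b) ⊗ (c , d) = (a * c - b * d , a * d + b * c + t * b * d)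

  ⊖_ : ℤ × ℤ → ℤ × ℤ
  ⊖ (a , b) = (- a , - b)

  private
    ⊗-assoc₁ : ∀ t a b c d e f → (a * c - b * d) * e - (a * d + b * c + t * b * d) * f
                                 ≡ a * (c * e - d * f) - b * (c * f + d * e + t * d * f)
    ⊗-assoc₁ = solve-∀
    ⊗-assoc₂ : ∀ t a b c d e f → (a * c - b * d) * f + (a * d + b * c + t * b * d) * e + t * (a * d + b * c + t * b * d) * f
                                 ≡ a * (c * f + d * e + t * d * f) + b * (c * e - d * f) + t * b * (c * f + d * e + t * d * f)
    ⊗-assoc₂ = solve-∀
    ⊗-comm₁ : ∀ a b c d → a * c - b * d ≡ c * a - d * b
    ⊗-comm₁ = solve-∀
    ⊗-comm₂ : ∀ t a b c d → a * d + b * c + t * b * d ≡ c * b + d * a + t * d * b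
    ⊗-comm₂ = solve-∀
    ⊗-identityˡ₁ : ∀ a b → 1ℤ * a - 0ℤ * b ≡ a
    ⊗-identityˡ₁ = solve-∀
    ⊗-identityˡ₂ : ∀ t a b → 1ℤ * b + 0ℤ * a + t * 0ℤ * b ≡ b
    ⊗-identityˡ₂ = solve-∀
    ⊗-distribˡ₁ : ∀ a b c d e f → a * (c + e) - b * (d + f) ≡ (a * c - b * d) + (a * e - b * f)
    ⊗-distribˡ₁ = solve-∀
    ⊗-distribˡ₂ : ∀ t a b c d e f → a * (d + f) + b * (c + e) + t * b * (d + f)
                                    ≡ (a * d + b * c + t * b * d) + (a * f + b * e + t * b * f)
    ⊗-distribˡ₂ = solve-∀

  ⊕-assoc : ∀ x y z → (x ⊕ y) ⊕ z ≡ x ⊕ (y ⊕ z)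
  ⊕-assoc (a , b) (c , d) (e , f) = cong₂ _,_ (ℤ.+-assoc a c e) (ℤ.+-assoc b d f)

  ⊕-comm : ∀ x y → x ⊕ y ≡ y ⊕ x
  ⊕-comm (a , b) (c , d) = cong₂ _,_ (ℤ.+-comm a c) (ℤ.+-comm b d)

  ⊕-identityˡ : ∀ x → (0ℤ , 0ℤ) ⊕ x ≡ x
  ⊕-identityˡ (a , b) = cong₂ _,_ (ℤ.+-identityˡ a) (ℤ.+-identityˡ b)

  ⊖-inverseˡ : ∀ x → ⊖ x ⊕ x ≡ (0ℤ , 0ℤ)
  ⊖-inverseˡ (a , b) = cong₂ _,_ (ℤ.+-inverseˡ a) (ℤ.+-inverseˡ b)

  ⊗-assoc : ∀ x y z → (x ⊗ y) ⊗ z ≡ x ⊗ (y ⊗ z)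
  ⊗-assoc (a , b) (c , d) (e , f) = cong₂ _,_ (⊗-assoc₁ t a b c d e f) (⊗-assoc₂ t a b c d e f)

  ⊗-comm : ∀ x y → x ⊗ y ≡ y ⊗ x
  ⊗-comm (a , b) (c , d) = cong₂ _,_ (⊗-comm₁ a b c d) (⊗-comm₂ t a b c d)

  ⊗-identityˡ : ∀ x → (1ℤ , 0ℤ) ⊗ x ≡ x
  ⊗-identityˡ (a , b) = cong₂ _,_ (⊗-identityˡ₁ a b) (⊗-identityˡ₂ t a b)

  ⊗-distribˡ : ∀ x y z → x ⊗ (y ⊕ z) ≡ x ⊗ y ⊕ x ⊗ z
  ⊗-distribˡ (a , b) (c , d) (e , f) = cong₂ _,_ (⊗-distribˡ₁ a b c d e f) (⊗-distribˡ₂ t a b c d e f)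

  ℤ[θ] : CommutativeRing 0ℓ 0ℓ
  ℤ[θ] = record
    { Carrier = ℤ × ℤ
    ; _≈_ = _≡_
    ; _+_ = _⊕_
    ; _*_ = _⊗_
    ; -_ = ⊖_
    ; 0# = (0ℤ , 0ℤ)
    ; 1# = (1ℤ , 0ℤ)
    ; isCommutativeRing = record
      { isRing = record
        { +-isAbelianGroup = record
          { isGroup = record
            { isMonoid = record
              { isSemigroup = record
                { isMagma = record { isEquivalence = isEquivalence ; ∙-cong = cong₂ _⊕_ }
                ; assoc   = ⊕-assoc
                }
              ; identity = ⊕-identityˡ , λ x → trans (⊕-comm x _) (⊕-identityˡ x)
              }
            ; inverse = ⊖-inverseˡ , λ x → trans (⊕-comm x (⊖ x)) (⊖-inverseˡ x)
            ; ⁻¹-cong = cong ⊖_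
            }
          ; comm = ⊕-comm
          }
        ; *-cong     = cong₂ _⊗_
        ; *-assoc    = ⊗-assoc
        ; *-identity = ⊗-identityˡ , λ x → trans (⊗-comm x _) (⊗-identityˡ x)
        ; distrib    = ⊗-distribˡ , λ x y z → trans (⊗-comm (y ⊕ z) x)
                         (trans (⊗-distribˡ x y z) (cong₂ _⊕_ (⊗-comm x y) (⊗-comm x z)))
        }
      ; *-comm = ⊗-comm
      }
    }

  module _ {n : ℕ} where

    infix 4 _≋_
    _≋_ : ℤ × ℤ → ℤ × ℤ → Set
    _≋_ = Pointwise (λ a b → a ≡ b mod n) (λ a b → a ≡ b mod n)

    ⊕-cong-mod : ∀ {x y u v} → x ≋ y → u ≋ v → x ⊕ u ≋ y ⊕ v
    ⊕-cong-mod (a≡ , b≡) (c≡ , d≡) = +-cong-mod a≡ c≡ , +-cong-mod b≡ d≡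

    ⊗-cong-mod : ∀ {x y u v} → x ≋ y → u ≋ v → x ⊗ u ≋ y ⊗ v
    ⊗-cong-mod (a≡ , b≡) (c≡ , d≡) =
      +-cong-mod (*-cong-mod a≡ c≡) (-‿cong-mod (*-cong-mod b≡ d≡)) ,
      +-cong-mod (+-cong-mod (*-cong-mod a≡ d≡) (*-cong-mod b≡ c≡))
                 (*-cong-mod (*-cong-mod (≡⇒≡-mod {a = t} refl) b≡) d≡)

    ⊖-cong-mod : ∀ {x y} → x ≋ y → ⊖ x ≋ ⊖ y
    ⊖-cong-mod (a≡ , b≡) = -‿cong-mod a≡ , -‿cong-mod b≡

  ℤ[θ]/_ : ℕ → CommutativeRing 0ℓ 0ℓ
  ℤ[θ]/ n = quotientRing (×-isEquivalence ≡-mod-isEquivalence ≡-mod-isEquivalence)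
                         (λ { refl → ≡⇒≡-mod refl , ≡⇒≡-mod refl })
                         (⊕-cong-mod {n}) ⊗-cong-mod ⊖-cong-mod
    where open Quotient ℤ[θ] using (quotientRing)

module PrimeField {p} (pr : Prime p) where

  open import Data.Integer.Base using (+_; -[1+_]; ∣_∣)
  import Data.Integer.Base as ℤ
  import Data.Integer.Properties as ℤₚ
  open import Data.Integer.DivMod using (_%ℕ_; n%ℕd<d)
  open import Data.Integer.Tactic.RingSolver using (solve-∀)
  open import Data.Nat.Base using (zero; suc; _<_; _∸_; z<s; nonTrivial⇒n>1)
  open import Data.Nat.Divisibility using (_∣_; divides)
  open import Data.Nat.Primality using (euclidsLemma; prime⇒nonZero; prime⇒nonTrivial)
  import Data.Nat.Properties as ℕₚ
  open import Data.Sum.Base using (_⊎_; inj₁; inj₂)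
  import Relation.Binary.PropositionalEquality as ≡
  open import Relation.Nullary.Negation using (¬_; contradiction)
  open IntegersModulo

  instance
    p≢0 : ℕ.NonZero p
    p≢0 = prime⇒nonZero pr

  open CommutativeRing (ℤ/ p)
  open import Algebra.Properties.Semiring.Exp semiring using (_^_; ^-congʳ)
  open import Algebra.Properties.Semiring.Mult semiring using (_×_)
  open import Relation.Binary.Reasoning.Setoid setoid

  ≈0⇒∣ : ∀ {a} → a ≈ 0# → p ∣ ∣ a ∣
  ≈0⇒∣ {a} (≡-mod k eq) =
    divides ∣ k ∣ (≡.trans (≡.cong ∣_∣ (≡.trans (≡.sym (ℤₚ.+-identityʳ a)) eq)) (ℤₚ.abs-* k (+ p)))

  ∣⇒≈0 : ∀ {a} → p ∣ ∣ a ∣ → a ≈ 0#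
  ∣⇒≈0 {+ n}       (divides q eq) = ≡-mod-intro (+ q)
    (≡.trans (≡.cong +_ eq) (≡.trans (ℤₚ.pos-* q p) (≡.sym (ℤₚ.+-identityˡ _))))
  ∣⇒≈0 { -[1+ n ] } (divides q eq) = ≡-mod-intro (- (+ q))
    (≡.trans (≡.cong (λ m → - (+ m)) eq) (≡.trans (≡.cong -_ (ℤₚ.pos-* q p))
      (≡.trans (ℤₚ.neg-distribˡ-* (+ q) (+ p)) (≡.sym (ℤₚ.+-identityˡ _)))))

  open import Algebra.Properties.Ring ring using (x∙y⁻¹≈ε⇒x≈y; x≈y⇒x∙y⁻¹≈ε; x[y-z]≈xy-xz; +-inverseˡ-unique)
  open import Algebra.Definitions _≈_ using (AlmostLeftCancellative)
  open Frobenius commutativeSemiring using ([m×1]^p≈m×1)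

  x*y≈0⇒x≈0⊎y≈0 : ∀ {x y} → x * y ≈ 0# → x ≈ 0# ⊎ y ≈ 0#
  x*y≈0⇒x≈0⊎y≈0 {x} {y} xy≈0 with euclidsLemma ∣ x ∣ ∣ y ∣ pr (≡.subst (p ∣_) (ℤₚ.abs-* x y) (≈0⇒∣ xy≈0))
  ... | inj₁ p∣x = inj₁ (∣⇒≈0 p∣x)
  ... | inj₂ p∣y = inj₂ (∣⇒≈0 p∣y)

  *-almostCancelˡ : AlmostLeftCancellative 0# _*_
  *-almostCancelˡ x y z x≉0 xy≈xz with x*y≈0⇒x≈0⊎y≈0 (trans (x[y-z]≈xy-xz x y z) (x≈y⇒x∙y⁻¹≈ε xy≈xz))
  ... | inj₁ x≈0   = contradiction x≈0 x≉0
  ... | inj₂ y-z≈0 = x∙y⁻¹≈ε⇒x≈y y z y-z≈0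

  ×1≡+ : ∀ m → m × 1# ≡.≡ + m
  ×1≡+ zero    = ≡.refl
  ×1≡+ (suc m) = ≡.cong (_+_ 1#) (×1≡+ m)

  p×1≈0 : p × 1# ≈ 0#
  p×1≈0 = trans (reflexive (×1≡+ p)) (n≡0-mod p)

  +m^p≈+m : ∀ m → (+ m) ^ p ≈ + m
  +m^p≈+m m = ≡.subst (λ a → a ^ p ≈ a) (×1≡+ m) ([m×1]^p≈m×1 pr p×1≈0 m)

  2≤p : 2 ℕ.≤ p
  2≤p with prime⇒nonTrivial pr
  ... | nt = nonTrivial⇒n>1 p {{nt}}

  +m*+m^[p∸2]≈1 : ∀ {m} → ¬ + m ≈ 0# → + m * (+ m) ^ (p ∸ 2) ≈ 1#
  +m*+m^[p∸2]≈1 {m} m≉0 = *-almostCancelˡ (+ m) _ _ m≉0 (begin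
    + m * (+ m * (+ m) ^ (p ∸ 2))  ≡⟨⟩
    (+ m) ^ (2 ℕ.+ (p ∸ 2))        ≈⟨ ^-congʳ (+ m) (ℕₚ.m+[n∸m]≡n 2≤p) ⟩
    (+ m) ^ p                      ≈⟨ +m^p≈+m m ⟩
    + m                          ≈⟨ *-identityʳ (+ m) ⟨
    + m * 1#                     ∎)

  +m≉0 : ∀ {m} → 0 < m → m < p → ¬ + m ≈ 0#
  +m≉0 0<m m<p m≈0 = ℕₚ.<⇒≢ 0<m (≡.sym (≡-mod⇒≡ m<p (ℕₚ.<-trans 0<m m<p) m≈0))

  +m≉0⇒0<m : ∀ {m} → ¬ + m ≈ 0# → 0 < m
  +m≉0⇒0<m {zero}  0≉0 = contradiction refl 0≉0
  +m≉0⇒0<m {suc m} _   = z<s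

  infixl 7 _÷_
  _÷_ : ℤ → ℕ → ℕ
  c ÷ y = (c * (+ y) ^ (p ∸ 2)) %ℕ p

  ÷<p : ∀ c y → c ÷ y < p
  ÷<p c y = n%ℕd<d (c * (+ y) ^ (p ∸ 2)) p

  y*[c÷y]≈c : ∀ c {y} → ¬ + y ≈ 0# → + y * + (c ÷ y) ≈ c
  y*[c÷y]≈c c {y} y≉0 = begin
    + y * + (c ÷ y)                ≈⟨ *-congˡ {+ y} (%ℕ-≡-mod (c * (+ y) ^ (p ∸ 2))) ⟩
    + y * (c * (+ y) ^ (p ∸ 2))      ≡⟨ x[cz]≡c[xz] (+ y) c ((+ y) ^ (p ∸ 2)) ⟩
    c * (+ y * (+ y) ^ (p ∸ 2))      ≈⟨ *-congˡ {c} (+m*+m^[p∸2]≈1 y≉0) ⟩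
    c * 1#                         ≈⟨ *-identityʳ c ⟩
    c                              ∎
    where
    x[cz]≡c[xz] : ∀ x c z → x ℤ.* (c ℤ.* z) ≡.≡ c ℤ.* (x ℤ.* z)
    x[cz]≡c[xz] = solve-∀

  c÷y≉0 : ∀ {c y} → ¬ c ≈ 0# → ¬ + y ≈ 0# → ¬ + (c ÷ y) ≈ 0#
  c÷y≉0 {c} {y} c≉0 y≉0 c÷y≈0 = c≉0 (begin
    c                ≈⟨ y*[c÷y]≈c c y≉0 ⟨
    + y * + (c ÷ y)  ≈⟨ *-congˡ {+ y} c÷y≈0 ⟩
    + y * 0#         ≈⟨ zeroʳ (+ y) ⟩
    0#               ∎)

  ÷-involutive : ∀ {c y} → ¬ c ≈ 0# → y < p → ¬ + y ≈ 0# → c ÷ (c ÷ y) ≡.≡ y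
  ÷-involutive {c} {y} c≉0 y<p y≉0 = ≡-mod⇒≡ (÷<p c (c ÷ y)) y<p
    (*-almostCancelˡ (+ (c ÷ y)) _ _ (c÷y≉0 c≉0 y≉0) (begin
      + (c ÷ y) * + (c ÷ (c ÷ y))  ≈⟨ y*[c÷y]≈c c (c÷y≉0 c≉0 y≉0) ⟩
      c                            ≈⟨ y*[c÷y]≈c c y≉0 ⟨
      + y * + (c ÷ y)              ≈⟨ *-comm (+ y) _ ⟩
      + (c ÷ y) * + y              ∎))

  private
    [x-1][x+1]≡x*x-1 : ∀ x → (x ℤ.- ℤ.1ℤ) ℤ.* (x ℤ.+ ℤ.1ℤ) ≡.≡ x ℤ.* x ℤ.- ℤ.1ℤ
    [x-1][x+1]≡x*x-1 = solve-∀

  x*x≈1⇒x≈±1 : ∀ {x} → x * x ≈ 1# → x ≈ 1# ⊎ x ≈ - 1#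
  x*x≈1⇒x≈±1 {x} x*x≈1 with x*y≈0⇒x≈0⊎y≈0 (trans (reflexive ([x-1][x+1]≡x*x-1 x)) (x≈y⇒x∙y⁻¹≈ε x*x≈1))
  ... | inj₁ x-1≈0 = inj₁ (x∙y⁻¹≈ε⇒x≈y x 1# x-1≈0)
  ... | inj₂ x+1≈0 = inj₂ (+-inverseˡ-unique x 1# x+1≈0)

module QuadraticResidues {p} (pr : Prime p) where

  open import Data.Integer.Base using (+_)
  import Data.Integer.Properties as ℤₚ
  open import Data.List.Base using (_∷ʳ_; map)
  open import Data.List.Membership.Propositional using (_∈_)
  open import Data.List.Properties using (applyUpTo-∷ʳ; length-applyUpTo)
  open import Data.Nat.Base using (zero; suc; _<_; _≤_; s≤s; z≤n)
  import Data.Nat.Properties as ℕₚ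
  open import Data.Product.Base using (_×_; _,_; proj₁; proj₂)
  open import Data.Sum.Base using ([_,_])
  import Relation.Binary.PropositionalEquality as ≡
  open import Relation.Nullary.Negation using (¬_; contradiction)
  open IntegersModulo
  open PrimeField pr
  open FreeInvolution using (FreeInvolutionOn)
  open Range

  open CommutativeRing (ℤ/ p)
  open PairedProduct commutativeSemiring using (∏; ∏-pairs; ∏-∷ʳ)
  open Frobenius commutativeSemiring using (1^n≈1)
  open import Algebra.Properties.Semiring.Exp semiring using (_^_)
  open import Algebra.Properties.Ring ring using (-1*x≈-x; -‿involutive; +-inverseˡ-unique)
  open import Algebra.Properties.CommutativeSemigroup *-commutativeSemigroup using (interchange)
  open import Relation.Binary.Reasoning.Setoid setoid

  NonResidue : ℤ → Set
  NonResidue c = ∀ y → ¬ (+ y * + y ≈ c)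

  module Wilson {g} (p≡3+2g : p ≡.≡ 3 ℕ.+ (g ℕ.+ g)) where

    p-1 : ℕ
    p-1 = 2 ℕ.+ (g ℕ.+ g)

    +[p-1]≈-1 : + p-1 ≈ - 1#
    +[p-1]≈-1 = +-inverseˡ-unique (+ p-1) 1# (trans (reflexive +[p-1]+1≡+p) (n≡0-mod p))
      where
      +[p-1]+1≡+p : + p-1 + 1# ≡.≡ + p
      +[p-1]+1≡+p = ≡.trans (≡.sym (ℤₚ.pos-+ p-1 1)) (≡.cong +_ (≡.trans (ℕₚ.+-comm p-1 1) (≡.sym p≡3+2g)))

    p-1<p : p-1 < p
    p-1<p = ≡.subst (p-1 <_) (≡.sym p≡3+2g) (ℕₚ.n<1+n p-1)

    -1*-1≈1 : - 1# * - 1# ≈ 1#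
    -1*-1≈1 = trans (-1*x≈-x (- 1#)) (-‿involutive 1#)

    ∈-middle⁻ : ∀ {y} → y ∈ range 2 (g ℕ.+ g) → y < p × ¬ + y ≈ 0# × ¬ + y * + y ≈ 1#
    ∈-middle⁻ {y} y∈ = y<p , +m≉0 (ℕₚ.<-trans (s≤s z≤n) 2≤y) y<p , y²≉1
      where
      2≤y = proj₁ (∈-range⁻ y∈)
      y<p-1 = proj₂ (∈-range⁻ y∈)
      y<p : y < p
      y<p = ℕₚ.<-trans y<p-1 p-1<p
      y²≉1 : ¬ + y * + y ≈ 1#
      y²≉1 y²≈1 = [ (λ y≈1 → ℕₚ.<⇒≢ 2≤y (≡.sym (≡-mod⇒≡ {a = y} {b = 1} y<p 2≤p y≈1)))
                  , (λ y≈-1 → ℕₚ.<⇒≢ y<p-1 (≡-mod⇒≡ {a = y} {b = p-1} y<p p-1<p (trans y≈-1 (sym +[p-1]≈-1))))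
                  ] (x*x≈1⇒x≈±1 y²≈1)

    ∈-middle⁺ : ∀ {y} → y < p → ¬ + y ≈ 0# → ¬ + y * + y ≈ 1# → y ∈ range 2 (g ℕ.+ g)
    ∈-middle⁺ {zero}              _   0≉0 _    = contradiction refl 0≉0
    ∈-middle⁺ {suc zero}          _   _   1≉1  = contradiction refl 1≉1
    ∈-middle⁺ {y@(suc (suc _))}   y<p _   y²≉1 = ∈-range⁺ (s≤s (s≤s z≤n)) (ℕₚ.≤∧≢⇒< y≤p-1 y≢p-1)
      where
      y≤p-1 : y ≤ p-1
      y≤p-1 = ℕ.s≤s⁻¹ (≡.subst (y <_) p≡3+2g y<p)
      y≢p-1 : y ≡.≢ p-1
      y≢p-1 ≡.refl = y²≉1 (trans (*-cong +[p-1]≈-1 +[p-1]≈-1) -1*-1≈1)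

    1≉0 : ¬ 1# ≈ 0#
    1≉0 = +m≉0 (s≤s z≤n) 2≤p

    inverse-free : FreeInvolutionOn (1# ÷_) (range 2 (g ℕ.+ g))
    inverse-free = record
      { closed           = closed
      ; fixed-point-free = fixed-point-free
      ; involutive       = λ y∈ → let y<p , y≉0 , _ = ∈-middle⁻ y∈ in ÷-involutive 1≉0 y<p y≉0
      }
      where
      fixed-point-free : ∀ {y} → y ∈ range 2 (g ℕ.+ g) → 1# ÷ y ≡.≢ y
      fixed-point-free {y} y∈ 1÷y≡y = let _ , y≉0 , y²≉1 = ∈-middle⁻ y∈ in
        y²≉1 (≡.subst (λ z → + y * + z ≈ 1#) 1÷y≡y (y*[c÷y]≈c 1# y≉0))

      closed : ∀ {y} → y ∈ range 2 (g ℕ.+ g) → 1# ÷ y ∈ range 2 (g ℕ.+ g)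
      closed {y} y∈ = ∈-middle⁺ (÷<p 1# y) (c÷y≉0 1≉0 y≉0) z²≉1
        where
        y≉0 = proj₁ (proj₂ (∈-middle⁻ y∈))
        z = + (1# ÷ y)
        z²≉1 : ¬ z * z ≈ 1#
        z²≉1 z²≈1 = proj₂ (proj₂ (∈-middle⁻ y∈)) (begin
          + y * + y              ≈⟨ *-identityʳ _ ⟨
          + y * + y * 1#         ≈⟨ *-congˡ {+ y * + y} z²≈1 ⟨
          + y * + y * (z * z)    ≈⟨ interchange (+ y) (+ y) z z ⟩
          + y * z * (+ y * z)    ≈⟨ *-cong (y*[c÷y]≈c 1# y≉0) (y*[c÷y]≈c 1# y≉0) ⟩
          1# * 1#                ≈⟨ *-identityˡ 1# ⟩
          1#                     ∎)

    ∏-middle≈1 : ∏ (map +_ (range 2 (g ℕ.+ g))) ≈ 1#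
    ∏-middle≈1 = trans (∏-pairs +_ g (length-applyUpTo (2 ℕ.+_) (g ℕ.+ g)) (range-unique 2 (g ℕ.+ g)) inverse-free
                           (λ y∈ → y*[c÷y]≈c 1# (proj₁ (proj₂ (∈-middle⁻ y∈)))))
                        (1^n≈1 g)

    wilson : ∏ (map +_ (range 1 p-1)) ≈ - 1#
    wilson = begin
      + 1 * ∏ (map +_ (range 2 (suc (g ℕ.+ g))))  ≡⟨ ≡.cong (λ xs → + 1 * ∏ (map +_ xs)) (applyUpTo-∷ʳ (2 ℕ.+_) (g ℕ.+ g)) ⟨
      + 1 * ∏ (map +_ (range 2 (g ℕ.+ g) ∷ʳ p-1))  ≈⟨ *-identityˡ _ ⟩
      ∏ (map +_ (range 2 (g ℕ.+ g) ∷ʳ p-1))        ≈⟨ ∏-∷ʳ +_ (range 2 (g ℕ.+ g)) p-1 ⟩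
      ∏ (map +_ (range 2 (g ℕ.+ g))) * + p-1       ≈⟨ *-cong ∏-middle≈1 +[p-1]≈-1 ⟩
      1# * - 1#                                    ≈⟨ *-identityˡ _ ⟩
      - 1#                                         ∎

  euler : ∀ {h c} → p ≡.≡ ℕ.suc (h ℕ.+ h) → NonResidue c → c ^ h ≈ - 1#
  euler {zero}          p≡1 _              = contradiction (≡.sym p≡1) (ℕₚ.<⇒≢ 2≤p)
  euler {h@(suc g)} {c} p≡1+2h nonResidue = begin
    c ^ h                                   ≈⟨ ∏-pairs +_ h (length-applyUpTo (1 ℕ.+_) (h ℕ.+ h))
                                                 (range-unique 1 (h ℕ.+ h)) free
                                                 (λ y∈ → y*[c÷y]≈c c (proj₂ (∈-units⁻ y∈))) ⟨
    ∏ (map +_ (range 1 (h ℕ.+ h)))           ≡⟨ ≡.cong (λ n → ∏ (map +_ (range 1 n))) (ℕₚ.+-suc h g) ⟩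
    ∏ (map +_ (range 1 (2 ℕ.+ (g ℕ.+ g))))   ≈⟨ Wilson.wilson {g} (≡.trans p≡1+2h (≡.cong suc (ℕₚ.+-suc h g))) ⟩
    - 1#                                    ∎
    where
    c≉0 : ¬ c ≈ 0#
    c≉0 c≈0 = nonResidue 0 (sym c≈0)

    ∈-units⁻ : ∀ {y} → y ∈ range 1 (h ℕ.+ h) → y < p × ¬ + y ≈ 0#
    ∈-units⁻ y∈ = let 1≤y , y<1+2h = ∈-range⁻ y∈ in
      ≡.subst (_ <_) (≡.sym p≡1+2h) y<1+2h , +m≉0 1≤y (≡.subst (_ <_) (≡.sym p≡1+2h) y<1+2h)

    free : FreeInvolutionOn (c ÷_) (range 1 (h ℕ.+ h))
    free = record
      { closed           = λ {y} y∈ → ∈-range⁺ (+m≉0⇒0<m (c÷y≉0 c≉0 (proj₂ (∈-units⁻ y∈))))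
                                                (≡.subst (c ÷ y <_) p≡1+2h (÷<p c y))
      ; fixed-point-free = λ {y} y∈ c÷y≡y → nonResidue y
                             (≡.subst (λ z → + y * + z ≈ c) c÷y≡y (y*[c÷y]≈c c (proj₂ (∈-units⁻ y∈))))
      ; involutive       = λ y∈ → let y<p , y≉0 = ∈-units⁻ y∈ in ÷-involutive c≉0 y<p y≉0
      }

module Eigenvalue {p} (pr : Prime p) {h} (p≡1+2h : p ≡ ℕ.suc (h ℕ.+ h)) (T : ℕ) where

  open import Data.Integer.Base as ℤ using (+_; 0ℤ; 1ℤ)
  open import Data.Integer.Tactic.RingSolver using (solve-∀)
  import Data.Nat.Properties as ℕₚ
  open import Data.Product.Base using (_,_; proj₁; proj₂)
  import Relation.Binary.PropositionalEquality as ≡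
  open import Relation.Nullary.Negation using (¬_; contradiction)
  open IntegersModulo
  open QuadraticIntegers (+ T) using (ℤ[θ]/_)
  open QuadraticResidues pr using (NonResidue; euler)
  module F where
    open CommutativeRing (ℤ/ p) public
    open import Algebra.Properties.Semiring.Exp semiring public using (_^_)
    open import Algebra.Properties.Ring ring public using (+-inverseˡ-unique)
    open PrimeField pr public
  open CommutativeRing (ℤ[θ]/ p)
  open import Algebra.Properties.Semiring.Exp semiring using (_^_; ^-congˡ; ^-congʳ; ^-homo-*)
  open import Algebra.Properties.Semiring.Mult semiring using (_×_)
  open import Algebra.Properties.CommutativeSemiring.Exp commutativeSemiring using (^-distrib-*)
  open import Algebra.Properties.Ring ring using (-1*x≈-x; -‿involutive)
  open Frobenius commutativeSemiring using ([x+y]^p≈x^p+y^p; [m×1]^p≈m×1; 1^n≈1)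
  open import Relation.Binary.Reasoning.Setoid setoid

  t : ℤ
  t = + T

  ι : ℤ → Carrier
  ι a = (a , 0ℤ)

  θ θ̄ : Carrier
  θ = (0ℤ , 1ℤ)
  θ̄ = (t , ℤ.-1ℤ)

  by-components : ∀ {a b c d} → a ≡ c → b ≡ d → (a , b) ≈ (c , d)
  by-components a≡c b≡d = ≡⇒≡-mod a≡c , ≡⇒≡-mod b≡d

  ι-cong : ∀ {a b} → a F.≈ b → ι a ≈ ι b
  ι-cong a≈b = a≈b , F.refl

  ι-* : ∀ a b → ι a * ι b ≈ ι (a ℤ.* b)
  ι-* a b = by-components (re a b) (im t a b)
    where
    re : ∀ a b → a ℤ.* b ℤ.- 0ℤ ℤ.* 0ℤ ≡ a ℤ.* b
    re = solve-∀
    im : ∀ t a b → a ℤ.* 0ℤ ℤ.+ 0ℤ ℤ.* b ℤ.+ t ℤ.* 0ℤ ℤ.* 0ℤ ≡ 0ℤ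
    im = solve-∀

  ι-^ : ∀ a n → ι a ^ n ≈ ι (a F.^ n)
  ι-^ a ℕ.zero    = refl
  ι-^ a (ℕ.suc n) = trans (*-congˡ {ι a} (ι-^ a n)) (ι-* a (a F.^ n))

  ι-*-scales : ∀ a x₁ x₂ → ι a * (x₁ , x₂) ≈ (a ℤ.* x₁ , a ℤ.* x₂)
  ι-*-scales a x₁ x₂ = by-components (re a x₁ x₂) (im t a x₁ x₂)
    where
    re : ∀ a x₁ x₂ → a ℤ.* x₁ ℤ.- 0ℤ ℤ.* x₂ ≡ a ℤ.* x₁
    re = solve-∀
    im : ∀ t a x₁ x₂ → a ℤ.* x₂ ℤ.+ 0ℤ ℤ.* x₁ ℤ.+ t ℤ.* 0ℤ ℤ.* x₂ ≡ a ℤ.* x₂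
    im = solve-∀

  ι-cancelˡ : ∀ {a} → ¬ a F.≈ F.0# → ∀ {x y} → ι a * x ≈ ι a * y → x ≈ y
  ι-cancelˡ {a} a≉0 {x₁ , x₂} {y₁ , y₂} ax≈ay =
    let ax₁≈ay₁ , ax₂≈ay₂ = trans (sym (ι-*-scales a x₁ x₂)) (trans ax≈ay (ι-*-scales a y₁ y₂))
    in F.*-almostCancelˡ a x₁ y₁ a≉0 ax₁≈ay₁ , F.*-almostCancelˡ a x₂ y₂ a≉0 ax₂≈ay₂

  ×1≡ι : ∀ m → m × 1# ≡ ι (+ m)
  ×1≡ι ℕ.zero    = ≡.refl
  ×1≡ι (ℕ.suc m) = ≡.cong (_+_ 1#) (×1≡ι m)

  p×1≈0 : p × 1# ≈ 0#
  p×1≈0 = trans (reflexive (×1≡ι p)) (ι-cong (n≡0-mod p))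

  ι[+m]^p≈ι[+m] : ∀ m → ι (+ m) ^ p ≈ ι (+ m)
  ι[+m]^p≈ι[+m] m = ≡.subst (λ x → x ^ p ≈ x) (×1≡ι m) ([m×1]^p≈m×1 pr p×1≈0 m)

  2<p : 2 ℕ.< p
  2<p = odd⇒2<p h p≡1+2h
    where
    odd⇒2<p : ∀ h → p ≡ ℕ.suc (h ℕ.+ h) → 2 ℕ.< p
    odd⇒2<p ℕ.zero    p≡1    = contradiction (≡.sym p≡1) (ℕₚ.<⇒≢ F.2≤p)
    odd⇒2<p (ℕ.suc g) p≡1+2h =
      ≡.subst (2 ℕ.<_) (≡.sym (≡.trans p≡1+2h (≡.cong ℕ.suc (ℕₚ.+-suc (ℕ.suc g) g)))) (ℕ.s≤s (ℕ.s≤s (ℕ.s≤s ℕ.z≤n)))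

  2≉0 : ¬ + 2 F.≈ F.0#
  2≉0 = F.+m≉0 (ℕ.s≤s ℕ.z≤n) 2<p

  module _ (Δ-nonResidue : NonResidue (t ℤ.* t ℤ.- + 4)) where

    w : Carrier
    w = (ℤ.- t , + 2)

    w*w≈ιΔ : w * w ≈ ι (t ℤ.* t ℤ.- + 4)
    w*w≈ιΔ = by-components (re t) (im t)
      where
      re : ∀ t → ℤ.- t ℤ.* ℤ.- t ℤ.- + 2 ℤ.* + 2 ≡ t ℤ.* t ℤ.- + 4
      re = solve-∀
      im : ∀ t → ℤ.- t ℤ.* + 2 ℤ.+ + 2 ℤ.* ℤ.- t ℤ.+ t ℤ.* + 2 ℤ.* + 2 ≡ 0ℤ
      im = solve-∀

    w^p≈-w : w ^ p ≈ - w
    w^p≈-w = begin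
      w ^ p                            ≈⟨ ^-congʳ w p≡1+2h ⟩
      w * w ^ (h ℕ.+ h)                ≈⟨ *-congˡ {w} (^-homo-* w h h) ⟩
      w * (w ^ h * w ^ h)              ≈⟨ *-congˡ {w} (^-distrib-* w w h) ⟨
      w * (w * w) ^ h                  ≈⟨ *-congˡ {w} (^-congˡ h w*w≈ιΔ) ⟩
      w * ι (t ℤ.* t ℤ.- + 4) ^ h      ≈⟨ *-congˡ {w} (ι-^ _ h) ⟩
      w * ι ((t ℤ.* t ℤ.- + 4) F.^ h)  ≈⟨ *-congˡ {w} (ι-cong (euler {h} p≡1+2h Δ-nonResidue)) ⟩
      w * - 1#                         ≈⟨ *-comm w (- 1#) ⟩
      - 1# * w                         ≈⟨ -1*x≈-x w ⟩
      - w                              ∎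

    θ^p≈θ̄ : θ ^ p ≈ θ̄
    θ^p≈θ̄ = ι-cancelˡ 2≉0 (begin
      ι (+ 2) * θ ^ p           ≈⟨ *-congʳ (ι[+m]^p≈ι[+m] 2) ⟨
      ι (+ 2) ^ p * θ ^ p       ≈⟨ ^-distrib-* (ι (+ 2)) θ p ⟨
      (ι (+ 2) * θ) ^ p         ≈⟨ ^-congˡ p 2θ≈w+ιt ⟩
      (w + ι t) ^ p             ≈⟨ [x+y]^p≈x^p+y^p pr p×1≈0 w (ι t) ⟩
      w ^ p + ι t ^ p           ≈⟨ +-cong w^p≈-w (ι[+m]^p≈ι[+m] T) ⟩
      - w + ι t                 ≈⟨ -w+ιt≈2θ̄ ⟩
      ι (+ 2) * θ̄               ∎)
      where
      2θ≈w+ιt : ι (+ 2) * θ ≈ w + ι t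
      2θ≈w+ιt = by-components (re t) (im t)
        where
        re : ∀ t → + 2 ℤ.* 0ℤ ℤ.- 0ℤ ℤ.* 1ℤ ≡ ℤ.- t ℤ.+ t
        re = solve-∀
        im : ∀ t → + 2 ℤ.* 1ℤ ℤ.+ 0ℤ ℤ.* 0ℤ ℤ.+ t ℤ.* 0ℤ ℤ.* 1ℤ ≡ + 2 ℤ.+ 0ℤ
        im = solve-∀
      -w+ιt≈2θ̄ : - w + ι t ≈ ι (+ 2) * θ̄
      -w+ιt≈2θ̄ = by-components (re t) (im t)
        where
        re : ∀ t → ℤ.- ℤ.- t ℤ.+ t ≡ + 2 ℤ.* t ℤ.- 0ℤ ℤ.* ℤ.-1ℤ
        re = solve-∀
        im : ∀ t → ℤ.- + 2 ℤ.+ 0ℤ ≡ + 2 ℤ.* ℤ.-1ℤ ℤ.+ 0ℤ ℤ.* t ℤ.+ t ℤ.* 0ℤ ℤ.* ℤ.-1ℤ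
        im = solve-∀

    θ^[p+1]≈1 : θ ^ ℕ.suc p ≈ 1#
    θ^[p+1]≈1 = trans (*-congˡ {θ} θ^p≈θ̄) (by-components (re t) (im t))
      where
      re : ∀ t → 0ℤ ℤ.* t ℤ.- 1ℤ ℤ.* ℤ.-1ℤ ≡ 1ℤ
      re = solve-∀
      im : ∀ t → 0ℤ ℤ.* ℤ.-1ℤ ℤ.+ 1ℤ ℤ.* t ℤ.+ t ℤ.* 1ℤ ℤ.* ℤ.-1ℤ ≡ 0ℤ
      im = solve-∀

    module _ (t+2-nonResidue : NonResidue (t ℤ.+ + 2)) where

      μ : Carrier
      μ = 1# + θ

      μ^[p+1]≈ι[t+2] : μ ^ ℕ.suc p ≈ ι (t ℤ.+ + 2)
      μ^[p+1]≈ι[t+2] = begin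
        μ * μ ^ p             ≈⟨ *-congˡ {μ} ([x+y]^p≈x^p+y^p pr p×1≈0 1# θ) ⟩
        μ * (1# ^ p + θ ^ p)  ≈⟨ *-congˡ {μ} (+-cong (1^n≈1 p) θ^p≈θ̄) ⟩
        μ * (1# + θ̄)          ≈⟨ by-components (re t) (im t) ⟩
        ι (t ℤ.+ + 2)         ∎
        where
        re : ∀ t → 1ℤ ℤ.* (1ℤ ℤ.+ t) ℤ.- 1ℤ ℤ.* (0ℤ ℤ.+ ℤ.-1ℤ) ≡ t ℤ.+ + 2
        re = solve-∀
        im : ∀ t → 1ℤ ℤ.* (0ℤ ℤ.+ ℤ.-1ℤ) ℤ.+ 1ℤ ℤ.* (1ℤ ℤ.+ t) ℤ.+ t ℤ.* 1ℤ ℤ.* (0ℤ ℤ.+ ℤ.-1ℤ) ≡ 0ℤ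
        im = solve-∀

      μ*μ≈ι[t+2]*θ : μ * μ ≈ ι (t ℤ.+ + 2) * θ
      μ*μ≈ι[t+2]*θ = by-components (re t) (im t)
        where
        re : ∀ t → 1ℤ ℤ.* 1ℤ ℤ.- 1ℤ ℤ.* 1ℤ ≡ (t ℤ.+ + 2) ℤ.* 0ℤ ℤ.- 0ℤ ℤ.* 1ℤ
        re = solve-∀
        im : ∀ t → 1ℤ ℤ.* 1ℤ ℤ.+ 1ℤ ℤ.* 1ℤ ℤ.+ t ℤ.* 1ℤ ℤ.* 1ℤ
                       ≡ (t ℤ.+ + 2) ℤ.* 1ℤ ℤ.+ 0ℤ ℤ.* 0ℤ ℤ.+ t ℤ.* 0ℤ ℤ.* 1ℤ
        im = solve-∀

      θ^[h+1]≈-1 : θ ^ ℕ.suc h ≈ - 1#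
      θ^[h+1]≈-1 = begin
        θ ^ ℕ.suc h      ≈⟨ -‿involutive (θ ^ ℕ.suc h) ⟨
        - (- θ ^ ℕ.suc h) ≈⟨ -‿cong -θ^[h+1]≈1 ⟩
        - 1#             ∎
        where
        s = t ℤ.+ + 2
        X = θ ^ ℕ.suc h
        s≉0 : ¬ s F.≈ F.0#
        s≉0 s≈0 = t+2-nonResidue 0 (F.sym s≈0)
        [h+1]+[h+1]≡p+1 : ℕ.suc h ℕ.+ ℕ.suc h ≡ ℕ.suc p
        [h+1]+[h+1]≡p+1 = ≡.cong ℕ.suc (≡.trans (ℕₚ.+-suc h h) (≡.sym p≡1+2h))
        -θ^[h+1]≈1 : - X ≈ 1#
        -θ^[h+1]≈1 = ι-cancelˡ s≉0 (begin
          ι s * - X                      ≈⟨ *-congˡ {ι s} (-1*x≈-x X) ⟨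
          ι s * (ι (F.- F.1#) * X)       ≈⟨ *-assoc (ι s) (ι (F.- F.1#)) X ⟨
          ι s * ι (F.- F.1#) * X         ≈⟨ *-congʳ (ι-* s (F.- F.1#)) ⟩
          ι (s F.* (F.- F.1#)) * X       ≈⟨ *-congʳ (ι-cong (F.*-congˡ {s} (euler {h} p≡1+2h t+2-nonResidue))) ⟨
          ι (s F.^ ℕ.suc h) * X          ≈⟨ *-congʳ (ι-^ s (ℕ.suc h)) ⟨
          ι s ^ ℕ.suc h * X              ≈⟨ ^-distrib-* (ι s) θ (ℕ.suc h) ⟨
          (ι s * θ) ^ ℕ.suc h            ≈⟨ ^-congˡ (ℕ.suc h) μ*μ≈ι[t+2]*θ ⟨
          (μ * μ) ^ ℕ.suc h              ≈⟨ ^-distrib-* μ μ (ℕ.suc h) ⟩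
          μ ^ ℕ.suc h * μ ^ ℕ.suc h      ≈⟨ ^-homo-* μ (ℕ.suc h) (ℕ.suc h) ⟨
          μ ^ (ℕ.suc h ℕ.+ ℕ.suc h)      ≈⟨ ^-congʳ μ [h+1]+[h+1]≡p+1 ⟩
          μ ^ ℕ.suc p                    ≈⟨ μ^[p+1]≈ι[t+2] ⟩
          ι s                            ≈⟨ *-identityʳ (ι s) ⟨
          ι s * 1#                       ∎)

  x≈-x⇒x≈0 : ∀ {x} → x ≈ - x → x ≈ 0#
  x≈-x⇒x≈0 {x} x≈-x = ι-cancelˡ 2≉0 (begin
    ι (+ 2) * x  ≈⟨ by-components (re (proj₁ x) (proj₂ x)) (im t (proj₁ x) (proj₂ x)) ⟩
    x + x        ≈⟨ +-congˡ {x} x≈-x ⟩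
    x + - x      ≈⟨ -‿inverseʳ x ⟩
    0#           ≈⟨ zeroʳ (ι (+ 2)) ⟨
    ι (+ 2) * 0# ∎)
    where
    re : ∀ a b → + 2 ℤ.* a ℤ.- 0ℤ ℤ.* b ≡ a ℤ.+ a
    re = solve-∀
    im : ∀ t a b → + 2 ℤ.* b ℤ.+ 0ℤ ℤ.* a ℤ.+ t ℤ.* 0ℤ ℤ.* b ≡ b ℤ.+ b
    im = solve-∀

module MarkoffTriples where

  open import Data.Fin.Base using (Fin; zero; suc)
  open import Data.Nat.Base using (zero; suc; _+_; _*_; _∸_; _<_; NonZero; s≤s; z≤n)
  open import Data.Nat.DivMod using (_%_; m<n⇒m%n≡m)
  open import Data.Nat.Divisibility using (m%n≡0⇒n∣m; ∣⇒≤)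
  open import Data.Nat.Primality using (euclidsLemma)
  open import Data.Nat.Properties using (<⇒≱; ≤-trans)
  open import Data.Nat.Tactic.RingSolver using (solve-∀)
  open import Data.Product.Base using (_×_; _,_)
  open import Data.Sum.Base using ([_,_])
  open import Relation.Binary.PropositionalEquality using (_≢_; refl; trans; cong; module ≡-Reasoning)
  open import Relation.Nullary.Negation using (contradiction)
  open import Defs using (Triple; InFp³; InXstar; rotTerm; rot; iter; coord)

  rotPair : (p : ℕ) → .{{NonZero p}} → ℕ → ℕ × ℕ → ℕ × ℕ
  rotPair p s (a , b) = (b , rotTerm p s b a)

  embed : Fin 3 → ℕ → ℕ × ℕ → Triple
  embed zero             s (a , b) = (s , a , b)
  embed (suc zero)       s (a , b) = (a , s , b)
  embed (suc (suc zero)) s (a , b) = (a , b , s)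

  others : Fin 3 → Triple → ℕ × ℕ
  others zero             (_  , x₂ , x₃) = (x₂ , x₃)
  others (suc zero)       (x₁ , _  , x₃) = (x₁ , x₃)
  others (suc (suc zero)) (x₁ , x₂ , _ ) = (x₁ , x₂)

  embed-others : ∀ i x → embed i (coord i x) (others i x) ≡ x
  embed-others zero             _ = refl
  embed-others (suc zero)       _ = refl
  embed-others (suc (suc zero)) _ = refl

  others-embed : ∀ i s q → others i (embed i s q) ≡ q
  others-embed zero             _ _ = refl
  others-embed (suc zero)       _ _ = refl
  others-embed (suc (suc zero)) _ _ = refl

  module _ {p} .{{_ : NonZero p}} where

    rot-embed : ∀ i s q → rot p i (embed i s q) ≡ embed i s (rotPair p s q)
    rot-embed zero             s q       = refl
    rot-embed (suc zero)       s q       = refl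
    rot-embed (suc (suc zero)) s (a , b) = cong (λ c → (b , (c + (p ∸ a)) % p , s)) (3ba≡3sb b s)
      where
      3ba≡3sb : ∀ b s → 3 * b * s ≡ 3 * s * b
      3ba≡3sb = solve-∀

    iter-rot-embed : ∀ n i s q → iter n (rot p i) (embed i s q) ≡ embed i s (iter n (rotPair p s) q)
    iter-rot-embed zero    i s q = refl
    iter-rot-embed (suc n) i s q = trans (cong (rot p i) (iter-rot-embed n i s q)) (rot-embed i s _)

    others-residues : ∀ i {x} → InFp³ p x → let (a , b) = others i x in a < p × b < p
    others-residues zero             (_    , x₂<p , x₃<p) = x₂<p , x₃<p
    others-residues (suc zero)       (x₁<p , _    , x₃<p) = x₁<p , x₃<p
    others-residues (suc (suc zero)) (x₁<p , x₂<p , _   ) = x₁<p , x₂<p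

    square≡0⇒≡0 : Prime p → ∀ {s} → s < p → (s * s) % p ≡ 0 → s ≡ 0
    square≡0⇒≡0 pr {zero}  _   _     = refl
    square≡0⇒≡0 pr {suc s} s<p s²≡0 =
      [ p∤1+s , p∤1+s ] (euclidsLemma (suc s) (suc s) pr (m%n≡0⇒n∣m _ p s²≡0))
      where
      p∤1+s = λ p∣1+s → contradiction (∣⇒≤ p∣1+s) (<⇒≱ s<p)

    others≢0 : Prime p → ∀ i x → InXstar p x → others i x ≢ (0 , 0)
    others≢0 pr zero (x₁ , .0 , .0) ((x₁<p , _) , nonzero , markoff) refl =
      nonzero (square≡0⇒≡0 pr x₁<p (begin
        (x₁ * x₁) % p                  ≡⟨ cong (_% p) (x²+0+0≡x² x₁) ⟨
        (x₁ * x₁ + 0 * 0 + 0 * 0) % p  ≡⟨ markoff ⟩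
        (3 * x₁ * 0 * 0) % p           ≡⟨ cong (_% p) (3x00≡0 x₁) ⟩
        0 % p                          ≡⟨ m<n⇒m%n≡m (≤-trans (s≤s z≤n) x₁<p) ⟩
        0                              ∎) , refl , refl)
      where
      open ≡-Reasoning
      x²+0+0≡x² : ∀ x → x * x + 0 * 0 + 0 * 0 ≡ x * x
      x²+0+0≡x² = solve-∀
      3x00≡0 : ∀ x → 3 * x * 0 * 0 ≡ 0
      3x00≡0 = solve-∀
    others≢0 pr (suc zero) (.0 , x₂ , .0) ((_ , x₂<p , _) , nonzero , markoff) refl =
      nonzero (refl , square≡0⇒≡0 pr x₂<p (begin
        (x₂ * x₂) % p                  ≡⟨ cong (_% p) (0+x²+0≡x² x₂) ⟨
        (0 * 0 + x₂ * x₂ + 0 * 0) % p  ≡⟨ markoff ⟩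
        0 % p                          ≡⟨ m<n⇒m%n≡m (≤-trans (s≤s z≤n) x₂<p) ⟩
        0                              ∎) , refl)
      where
      open ≡-Reasoning
      0+x²+0≡x² : ∀ x → 0 * 0 + x * x + 0 * 0 ≡ x * x
      0+x²+0≡x² = solve-∀
    others≢0 pr (suc (suc zero)) (.0 , .0 , x₃) ((_ , _ , x₃<p) , nonzero , markoff) refl =
      nonzero (refl , refl , square≡0⇒≡0 pr x₃<p (begin
        (x₃ * x₃) % p                  ≡⟨ markoff ⟩
        0 % p                          ≡⟨ m<n⇒m%n≡m (≤-trans (s≤s z≤n) x₃<p) ⟩
        0                              ∎))
      where open ≡-Reasoning

module PairRotation {p} (pr : Prime p) {h} (p≡1+2h : p ≡ ℕ.suc (h ℕ.+ h)) (s : ℕ) where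

  open import Data.Integer.Base as ℤ using (+_; 0ℤ; 1ℤ)
  import Data.Integer.Properties as ℤₚ
  open import Data.Integer.Tactic.RingSolver using (solve-∀)
  open import Data.Nat.DivMod using (m%n<n)
  import Data.Nat.Properties as ℕₚ
  open import Data.Product.Base using (_×_; _,_; proj₁)
  import Relation.Binary.PropositionalEquality as ≡
  open import Defs using (rotTerm; iter)
  open MarkoffTriples using (rotPair)
  open IntegersModulo
  open QuadraticIntegers (+ (3 ℕ.* s)) using (ℤ[θ]/_)
  open Eigenvalue pr {h} p≡1+2h (3 ℕ.* s)
  open CommutativeRing (ℤ[θ]/ p) using (Carrier; _≈_; _*_; 1#)
  open import Algebra.Properties.Semiring.Exp (CommutativeRing.semiring (ℤ[θ]/ p)) using (_^_)

  Residues : ℕ × ℕ → Set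
  Residues (a , b) = a ℕ.< p × b ℕ.< p

  step : ℕ × ℕ → ℕ × ℕ
  step = rotPair p s

  step-residues : ∀ {q} → Residues q → Residues (step q)
  step-residues {a , b} (_ , b<p) = b<p , m%n<n _ p

  iter-residues : ∀ n {q} → Residues q → Residues (iter n step q)
  iter-residues ℕ.zero    r = r
  iter-residues (ℕ.suc n) r = step-residues (iter-residues n r)

  -- b - aθ̄, where θ̄ = t - θ is the conjugate of θ
  ψ : ℕ × ℕ → Carrier
  ψ (a , b) = (+ b ℤ.- t ℤ.* + a , + a)

  +rotTerm≈tb-a : ∀ {a} b → a ℕ.≤ p → + rotTerm p s b a F.≈ t ℤ.* + b ℤ.- + a
  +rotTerm≈tb-a {a} b a≤p = begin
    + rotTerm p s b a                  ≈⟨ %-≡-mod (3 ℕ.* s ℕ.* b ℕ.+ (p ℕ.∸ a)) ⟩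
    + (3 ℕ.* s ℕ.* b ℕ.+ (p ℕ.∸ a))    ≡⟨ ≡.trans (ℤₚ.pos-+ _ (p ℕ.∸ a)) (≡.cong (ℤ._+ + (p ℕ.∸ a)) (ℤₚ.pos-* (3 ℕ.* s) b)) ⟩
    t ℤ.* + b ℤ.+ + (p ℕ.∸ a)          ≈⟨ F.+-congˡ {t ℤ.* + b} +[p∸a]≈-a ⟩
    t ℤ.* + b ℤ.- + a                  ∎
    where
    open import Relation.Binary.Reasoning.Setoid F.setoid
    +[p∸a]≈-a : + (p ℕ.∸ a) F.≈ F.- + a
    +[p∸a]≈-a = F.+-inverseˡ-unique (+ (p ℕ.∸ a)) (+ a)
      (F.trans (F.reflexive (≡.trans (≡.sym (ℤₚ.pos-+ (p ℕ.∸ a) a)) (≡.cong +_ (ℕₚ.m∸n+n≡m a≤p)))) (n≡0-mod p))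

  ψ-step : ∀ {a b} → a ℕ.< p → ψ (step (a , b)) ≈ θ * ψ (a , b)
  ψ-step {a} {b} a<p =
    F.trans (F.+-congʳ {ℤ.- (t ℤ.* + b)} (+rotTerm≈tb-a b (ℕₚ.<⇒≤ a<p))) (F.reflexive (re t (+ a) (+ b))) ,
    F.reflexive (im t (+ a) (+ b))
    where
    re : ∀ t a b → t ℤ.* b ℤ.- a ℤ.- t ℤ.* b ≡ 0ℤ ℤ.* (b ℤ.- t ℤ.* a) ℤ.- 1ℤ ℤ.* a
    re = solve-∀
    im : ∀ t a b → b ≡ 0ℤ ℤ.* a ℤ.+ 1ℤ ℤ.* (b ℤ.- t ℤ.* a) ℤ.+ t ℤ.* 1ℤ ℤ.* a
    im = solve-∀

  open CommutativeRing (ℤ[θ]/ p) using (refl; sym; trans; *-congˡ; *-congʳ; *-assoc; *-identityˡ; -_; 0#)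

  ψ-iter : ∀ n {q} → Residues q → ψ (iter n step q) ≈ θ ^ n * ψ q
  ψ-iter ℕ.zero    {q} _ = sym (*-identityˡ (ψ q))
  ψ-iter (ℕ.suc n) {q} r = begin
    ψ (step (iter n step q))   ≈⟨ ψ-step (proj₁ (iter-residues n r)) ⟩
    θ * ψ (iter n step q)      ≈⟨ *-congˡ {θ} (ψ-iter n r) ⟩
    θ * (θ ^ n * ψ q)          ≈⟨ *-assoc θ (θ ^ n) (ψ q) ⟨
    θ ^ ℕ.suc n * ψ q          ∎
    where open import Relation.Binary.Reasoning.Setoid (CommutativeRing.setoid (ℤ[θ]/ p))

  ψ-injective : ∀ {q q′} → Residues q → Residues q′ → ψ q ≈ ψ q′ → q ≡ q′
  ψ-injective {a , b} {a′ , b′} (a<p , b<p) (a′<p , b′<p) (e₁ , e₂) =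
    ≡.cong₂ _,_ (≡-mod⇒≡ a<p a′<p e₂) (≡-mod⇒≡ b<p b′<p (begin
      + b                                  ≡⟨ x≡[x-y]+y (+ b) (t ℤ.* + a) ⟩
      (+ b ℤ.- t ℤ.* + a) ℤ.+ t ℤ.* + a     ≈⟨ F.+-cong e₁ (F.*-congˡ {t} e₂) ⟩
      (+ b′ ℤ.- t ℤ.* + a′) ℤ.+ t ℤ.* + a′  ≡⟨ x≡[x-y]+y (+ b′) (t ℤ.* + a′) ⟨
      + b′                                 ∎))
    where
    open import Relation.Binary.Reasoning.Setoid F.setoid
    x≡[x-y]+y : ∀ x y → x ≡ (x ℤ.- y) ℤ.+ y
    x≡[x-y]+y = solve-∀

  open QuadraticResidues pr using (NonResidue)

  module _ (Δ-nonResidue : NonResidue (t ℤ.* t ℤ.- + 4)) (t+2-nonResidue : NonResidue (t ℤ.+ + 2)) where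

    open import Relation.Binary.Reasoning.Setoid (CommutativeRing.setoid (ℤ[θ]/ p))
    open import Algebra.Properties.Ring (CommutativeRing.ring (ℤ[θ]/ p)) using (-1*x≈-x)

    step-period : ∀ {q} → Residues q → iter (ℕ.suc p) step q ≡ q
    step-period {q} r = ψ-injective (iter-residues (ℕ.suc p) r) r (begin
      ψ (iter (ℕ.suc p) step q)  ≈⟨ ψ-iter (ℕ.suc p) r ⟩
      θ ^ ℕ.suc p * ψ q          ≈⟨ *-congʳ (θ^[p+1]≈1 Δ-nonResidue) ⟩
      1# * ψ q                   ≈⟨ *-identityˡ (ψ q) ⟩
      ψ q                        ∎)

    step-half-period : ∀ {q} → Residues q → q ≡.≢ (0 , 0) → iter (ℕ.suc h) step q ≡.≢ q
    step-half-period {q} r q≢0 return = q≢0 (ψ-injective r (0<p , 0<p) (trans (x≈-x⇒x≈0 ψq≈-ψq) 0≈ψ[0,0]))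
      where
      0<p = ℕₚ.<-trans (ℕ.s≤s ℕ.z≤n) F.2≤p
      ψq≈-ψq : ψ q ≈ - ψ q
      ψq≈-ψq = begin
        ψ q                           ≡⟨ ≡.cong ψ return ⟨
        ψ (iter (ℕ.suc h) step q)     ≈⟨ ψ-iter (ℕ.suc h) r ⟩
        θ ^ ℕ.suc h * ψ q             ≈⟨ *-congʳ (θ^[h+1]≈-1 Δ-nonResidue t+2-nonResidue) ⟩
        - 1# * ψ q                    ≈⟨ -1*x≈-x (ψ q) ⟩
        - ψ q                         ∎
      0≈ψ[0,0] : 0# ≈ ψ (0 , 0)
      0≈ψ[0,0] = by-components (re t) ≡.refl
        where
        re : ∀ t → 0ℤ ≡ 0ℤ ℤ.- t ℤ.* 0ℤ
        re = solve-∀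

module MarkoffRotation {p} (pr : Prime p) where

  open import Data.Integer.Base as ℤ using (+_)
  import Data.Integer.Properties as ℤₚ
  open import Data.Integer.Tactic.RingSolver using (solve-∀)
  open import Data.Nat.Base using (suc; _+_; _*_; _^_; _<_)
  open import Data.Nat.Divisibility using (_∣_)
  import Data.Nat.Properties as ℕₚ
  import Data.Nat.Tactic.RingSolver as ℕ-Solver
  open import Data.Product.Base using (∃; _×_; _,_; proj₁)
  open import Data.Product.Properties using (≡-dec)
  open import Function.Base using (_∘_)
  import Relation.Binary.PropositionalEquality as ≡
  open import Defs using (InXstar; Elliptic; LegendreMinusOne; coord; rot; iter)
  open IntegersModulo
  open PrimeField pr using (p≢0)
  open QuadraticResidues pr using (NonResidue)
  open MarkoffTriples
  open LeastPeriod using (IsLeastPeriod; leastPeriod; leastPeriod-2-adic)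
  open CommutativeRing (ℤ/ p) using (trans; reflexive; +-congʳ)

  elliptic⇒nonResidue : ∀ s → Elliptic p s → NonResidue (+ (3 * s) ℤ.* + (3 * s) ℤ.- + 4)
  elliptic⇒nonResidue s elliptic y y²≈Δ = elliptic (y , ≡-mod⇒%≡ (begin
    + (y * y + 4)                            ≡⟨ ≡.trans (ℤₚ.pos-+ (y * y) 4) (≡.cong (ℤ._+ + 4) (ℤₚ.pos-* y y)) ⟩
    + y ℤ.* + y ℤ.+ + 4                      ≈⟨ +-congʳ y²≈Δ ⟩
    + (3 * s) ℤ.* + (3 * s) ℤ.- + 4 ℤ.+ + 4  ≡⟨ Δ+4≡t² (+ (3 * s)) ⟩
    + (3 * s) ℤ.* + (3 * s)                  ≡⟨ ℤₚ.pos-* (3 * s) (3 * s) ⟨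
    + (3 * s * (3 * s))                      ≡⟨ ≡.cong +_ ([3s]²≡9ss s) ⟩
    + (9 * s * s)                            ∎))
    where
    open import Relation.Binary.Reasoning.Setoid (CommutativeRing.setoid (ℤ/ p))
    Δ+4≡t² : ∀ t → t ℤ.* t ℤ.- + 4 ℤ.+ + 4 ≡ t ℤ.* t
    Δ+4≡t² = solve-∀
    [3s]²≡9ss : ∀ s → 3 * s * (3 * s) ≡ 9 * s * s
    [3s]²≡9ss = ℕ-Solver.solve-∀

  legendre⇒nonResidue : ∀ s → LegendreMinusOne p (3 * s + 2) → NonResidue (+ (3 * s) ℤ.+ + 2)
  legendre⇒nonResidue s (_ , nonSquare) y y²≈t+2 = nonSquare (y , ≡-mod⇒%≡ (trans (reflexive (ℤₚ.pos-* y y)) y²≈t+2))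

  module _ {h} (p≡1+2h : p ≡ suc (h + h)) where

    rot-returns : ∀ x i → InXstar p x → Elliptic p (coord i x) → LegendreMinusOne p (3 * coord i x + 2) →
                  iter (suc p) (rot p i) x ≡ x × iter (suc h) (rot p i) x ≡.≢ x
    rot-returns x i x∈X* elliptic legendre = returnₚ₊₁ , ¬returnₕ₊₁
      where
      s = coord i x
      q = others i x
      open PairRotation pr {h} p≡1+2h s using (step; step-period; step-half-period)
      open ≡.≡-Reasoning
      q-residues = others-residues i (proj₁ x∈X*)
      Δ-nonResidue = elliptic⇒nonResidue s elliptic
      t+2-nonResidue = legendre⇒nonResidue s legendre

      returnₚ₊₁ : iter (suc p) (rot p i) x ≡ x
      returnₚ₊₁ = begin
        iter (suc p) (rot p i) x              ≡⟨ ≡.cong (iter (suc p) (rot p i)) (embed-others i x) ⟨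
        iter (suc p) (rot p i) (embed i s q)  ≡⟨ iter-rot-embed (suc p) i s q ⟩
        embed i s (iter (suc p) step q)       ≡⟨ ≡.cong (embed i s) (step-period Δ-nonResidue t+2-nonResidue q-residues) ⟩
        embed i s q                           ≡⟨ embed-others i x ⟩
        x                                     ∎

      ¬returnₕ₊₁ : iter (suc h) (rot p i) x ≡.≢ x
      ¬returnₕ₊₁ returnₕ₊₁ = step-half-period Δ-nonResidue t+2-nonResidue
        q-residues (others≢0 pr i x x∈X*) (begin
          iter (suc h) step q                              ≡⟨ others-embed i s _ ⟨
          others i (embed i s (iter (suc h) step q))       ≡⟨ ≡.cong (others i) (iter-rot-embed (suc h) i s q) ⟨
          others i (iter (suc h) (rot p i) (embed i s q))  ≡⟨ ≡.cong (others i ∘ iter (suc h) (rot p i)) (embed-others i x) ⟩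
          others i (iter (suc h) (rot p i) x)              ≡⟨ ≡.cong (others i) returnₕ₊₁ ⟩
          others i x                                       ∎)

    rot-order-2-adic : ∀ x i → InXstar p x → Elliptic p (coord i x) → LegendreMinusOne p (3 * coord i x + 2) →
                       ∀ ν → 2 ^ ν ∣ p + 1 → ∃ λ n → IsLeastPeriod (rot p i) x n × 2 ^ ν ∣ n
    rot-order-2-adic x i x∈X* elliptic legendre ν 2^ν∣p+1 =
      let returnₚ₊₁ , ¬returnₕ₊₁ = rot-returns x i x∈X* elliptic legendre
          n , isOrder = leastPeriod (rot p i) (≡-dec ℕₚ._≟_ (≡-dec ℕₚ._≟_ ℕₚ._≟_)) {x} {p} returnₚ₊₁
      in n , isOrder , leastPeriod-2-adic (rot p i) {x} {n} {suc h} {ν} isOrder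
                         (≡.subst (λ k → iter k (rot p i) x ≡ x) p+1≡2[h+1] returnₚ₊₁) ¬returnₕ₊₁
                         (≡.subst (2 ^ ν ∣_) (≡.trans (ℕₚ.+-comm p 1) p+1≡2[h+1]) 2^ν∣p+1)
      where
      p+1≡2[h+1] : suc p ≡ 2 * suc h
      p+1≡2[h+1] = ≡.trans (≡.cong suc p≡1+2h) (2+2h≡2[1+h] h)
        where
        2+2h≡2[1+h] : ∀ h → suc (suc (h + h)) ≡ 2 * suc h
        2+2h≡2[1+h] = ℕ-Solver.solve-∀

open import Defs
open import Data.Nat using (ℕ; _+_; _*_; _^_; _<_; NonZero)
open import Data.Nat.Primality using (Prime)
open import Data.Nat.Divisibility using (_∣_)
open import Data.Fin using (Fin)
open import Data.Product using (_×_; Σ)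
open import Data.Nat.Properties using (<-trans)
open import Data.Product using (_,_)
open Primes using (odd-prime)

theorem2p10 : (p : ℕ) → .{{_ : NonZero p}} → Prime p → 5 < p →
    (x : Triple) → InXstar p x → (i : Fin 3) →
    Elliptic p (coord i x) → LegendreMinusOne p (3 * coord i x + 2) →
    (ν : ℕ) → IsTwoAdicVal ν (p + 1) →
    Σ ℕ (λ n → IsRotOrder p i x n × (2 ^ ν ∣ n))
theorem2p10 p pr 5<p x x∈X* i elliptic legendre ν (2^ν∣p+1 , _) =
  let h , p≡1+2h = odd-prime pr (<-trans (ℕ.s≤s (ℕ.s≤s (ℕ.s≤s ℕ.z≤n))) 5<p)
  in MarkoffRotation.rot-order-2-adic pr {h} p≡1+2h x i x∈X* elliptic legendre ν 2^ν∣p+1
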